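{- Let $c_1,c_2,d_1,d_2\in\mathbb{Z}$ with $c_1-c_2\ge0>d_1-d_2$, and let $a=c_1-c_2-d_1+d_2$. Then \[ \mathcal{C}_{(0|c_1,c_2)}\cap\mathcal{C}_{(0|d_1,d_2)}=\mathcal{C}_{(a|c_1,c_2)}. \]
   Context: A bipartition is a pair $(\lambda,\mu)$ of partitions, with nodes $(a',b,1)$ for $b\le\lambda_{a'}$ and $(a',b,2)$ for $b\le\mu_{a'}$. For $s\ge0$ and $(c_1,c_2)\in\mathbb{Z}^2$, the $(s\,|\,c_1,c_2)$-residue of a node $(a',b,k)$ is $b-a'+c_k+s\mathbb{Z}$ (the integer $b-a'+c_k$ if $s=0$), the content of a bipartition is the multiset of residues of its nodes, and a bipartition is an $(s\,|\,c_1,c_2)$-core if no other bipartition has the same content, except that for $s=1$ the only core is $(\varnothing,\varnothing)$. $\mathcal{C}_{(s|c_1,c_2)}$ is the set of such cores. -}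

module Defs where

open import Data.Nat as ℕ using (ℕ; zero; suc)
open import Data.Integer as ℤ using (ℤ; +_; _-_; _+_)
open import Data.Integer.DivMod using (_%ℕ_)
open import Data.List using (List; []; _∷_; _++_; map; applyUpTo)
open import Data.List.Relation.Unary.All using (All)
open import Data.List.Relation.Unary.Linked using (Linked)
open import Data.List.Relation.Binary.Permutation.Propositional using (_↭_)
open import Data.Product using (_×_; _,_)
open import Relation.Binary.PropositionalEquality using (_≡_)

IsPartition : List ℕ → Set
IsPartition xs = All (λ x → 0 ℕ.< x) xs × Linked ℕ._≥_ xs

IsBipartition : List ℕ × List ℕ → Set
IsBipartition (l , m) = IsPartition l × IsPartition m

-- residue map ℤ → ℤ/sℤ, with representatives: s = 0 gives x itself,
-- s > 0 gives the least non-negative representative.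
residue : ℕ → ℤ → ℤ
residue zero    x = x
residue (suc k) x = + (x %ℕ suc k)

-- integers b - a' + c for the nodes (a', b) of a component with charge c,
-- rows a' numbered from i.
compContents : ℤ → ℕ → List ℕ → List ℤ
compContents c i []       = []
compContents c i (ℓ ∷ ls) =
  map (λ b → (+ b - + i) + c) (applyUpTo suc ℓ) ++ compContents c (suc i) ls

-- the (s | c1, c2)-content of a bipartition, as a list (multiset up to ↭).
content : ℕ → ℤ → ℤ → List ℕ × List ℕ → List ℤ
content s c₁ c₂ (l , m) = map (residue s) (compContents c₁ 1 l ++ compContents c₂ 1 m)

IsCore : ℕ → ℤ → ℤ → List ℕ × List ℕ → Set
IsCore 1 c₁ c₂ β = β ≡ ([] , [])
IsCore s c₁ c₂ β =
  IsBipartition β ×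
  (∀ ν → IsBipartition ν → content s c₁ c₂ ν ↭ content s c₁ c₂ β → ν ≡ β)

-- Write c₁ = c₂ + k and d₂ = d₁ + m, so that a = k + m. Padding λ to N + k and μ to N parts puts
-- the two components on one scale, and the β-numbers (bead positions) P₁ = {λᵢ + N + k - i} and
-- P₂ = {μᵢ + N - i} determine the content: a value occurs as often as there are beads at or above
-- it, less the same count for the empty bipartition. Hence a (0 | c₁, c₂)-core has P₂ ⊆ P₁, since
-- otherwise two beads could be exchanged without changing the content, and symmetrically a
-- (0 | d₁, d₂)-core has P₁ - a ⊆ P₂. So on each runner of the abacus with a runners the beads of
-- P₁ and P₂ interlace, and below every height they hold as many beads of that runner as any
-- pair of bead sets can. The (a | c₁, c₂)-content fixes the number of beads, their sum and the
-- number on each runner; for another bipartition with that content the bead counts below every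
-- height are then dominated by those of (λ, μ) and have the same total, hence are equal.
-- Conversely an (a | c₁, c₂)-core is a core for the finer 0-contents, for the charges (c₁, c₂)
-- as well as for (d₁, d₂), which differ from them by a common shift plus a on the first charge.
-- For a = 1 interlacing makes both bead sets initial segments, so only (∅, ∅) is left.

module Submission where

open import Defs

module BipartitionCores where

  open import Data.Bool using (Bool; true; false; T; _∧_; if_then_else_)
  open import Data.Bool.Properties using (∧-zeroʳ; T-∧)
  open import Data.Empty using (⊥; ⊥-elim)
  open import Data.List using (List; []; _∷_; _++_; map; length; replicate; applyUpTo; downFrom)
  open import Data.List.Properties using (++-conicalˡ; ++-conicalʳ; length-++; ++-assoc; ++-identityʳ; length-replicate; length-map; map-++; map-cong; map-∘; map-id; map-applyUpTo; ∷-injectiveˡ; ∷-injectiveʳ)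
  open import Data.List.Relation.Binary.Permutation.Propositional as ↭ using (_↭_; ↭-sym)
  open import Data.List.Relation.Binary.Permutation.Propositional.Properties using (shift; map⁺; ++-comm; ↭-length; ↭-empty-inv)
  open import Data.List.Relation.Unary.All as All using (All; []; _∷_)
  open import Data.List.Relation.Unary.AllPairs using (AllPairs; []; _∷_)
  open import Data.List.Relation.Unary.Linked as Linked using (Linked; []; [-]; _∷_)
  open import Data.Nat
  open import Data.Nat.DivMod
  open import Data.Nat.ListAction using (sum)
  open import Data.Nat.ListAction.Properties using (sum-++)
  open import Data.Nat.Properties
  open import Algebra.Properties.CommutativeSemigroup +-commutativeSemigroup using (interchange; x∙yz≈y∙xz; xy∙z≈y∙xz)
  open import Data.Nat.Solver using (module +-*-Solver)
  open import Data.Integer as ℤ using (ℤ; -[1+_])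
  import Data.Integer.Properties as ℤ
  open import Data.Integer.Tactic.RingSolver using (solve-∀)
  open import Data.Product using (Σ; _×_; _,_; proj₁; proj₂)
  open import Data.Sum using (_⊎_; inj₁; inj₂; [_,_])
  open import Data.Unit using (tt)
  open import Function using (_∘_; case_of_)
  open import Function.Bundles using (_⇔_; mk⇔; Equivalence)
  open import Relation.Binary using (tri<; tri≈; tri>)
  open import Relation.Binary.PropositionalEquality hiding ([_])
  open import Relation.Nullary using (¬_; yes; no)
  open import Relation.Nullary.Decidable using (⌊_⌋)

  -- Counting with Boolean predicates

  𝟙 : Bool → ℕ
  𝟙 true  = 1
  𝟙 false = 0

  𝟙-mono : ∀ {b c} → (T b → T c) → 𝟙 b ≤ 𝟙 c
  𝟙-mono {true}  {true}  f = ≤-refl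
  𝟙-mono {true}  {false} f = ⊥-elim (f tt)
  𝟙-mono {false}         f = z≤n

  𝟙-∧ : ∀ b c → 𝟙 (b ∧ c) ≡ 𝟙 b * 𝟙 c
  𝟙-∧ true  c = sym (+-identityʳ (𝟙 c))
  𝟙-∧ false c = refl

  T⇒≡true : ∀ {b} → T b → b ≡ true
  T⇒≡true {true} _ = refl

  ≡true⇒T : ∀ {b} → b ≡ true → T b
  ≡true⇒T refl = tt

  ¬T⇒≡false : ∀ {b} → ¬ T b → b ≡ false
  ¬T⇒≡false {true}  ¬t = ⊥-elim (¬t tt)
  ¬T⇒≡false {false} _  = refl

  ≡ᵇ-refl : ∀ n → (n ≡ᵇ n) ≡ true
  ≡ᵇ-refl n = T⇒≡true (≡⇒≡ᵇ n n refl)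

  ≢⇒≡ᵇ-false : ∀ m n → m ≢ n → (m ≡ᵇ n) ≡ false
  ≢⇒≡ᵇ-false m n m≢n = ¬T⇒≡false (λ t → m≢n (≡ᵇ⇒≡ m n t))

  ≡ᵇ-sym : ∀ m n → (m ≡ᵇ n) ≡ (n ≡ᵇ m)
  ≡ᵇ-sym m n with m ≟ n
  ... | yes refl = refl
  ... | no m≢n   = trans (≢⇒≡ᵇ-false m n m≢n) (sym (≢⇒≡ᵇ-false n m (λ e → m≢n (sym e))))

  ≡ᵇ-cong-⇔ : ∀ m n m′ n′ → (m ≡ n → m′ ≡ n′) → (m′ ≡ n′ → m ≡ n) → (m ≡ᵇ n) ≡ (m′ ≡ᵇ n′)
  ≡ᵇ-cong-⇔ m n m′ n′ f g with m ≟ n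
  ... | yes refl rewrite f refl = trans (≡ᵇ-refl m) (sym (≡ᵇ-refl n′))
  ... | no m≢n = trans (≢⇒≡ᵇ-false m n m≢n) (sym (≢⇒≡ᵇ-false m′ n′ (λ e → m≢n (g e))))

  <⇒<ᵇ-true : ∀ {m n} → m < n → (m <ᵇ n) ≡ true
  <⇒<ᵇ-true m<n = T⇒≡true (<⇒<ᵇ m<n)

  ≮⇒<ᵇ-false : ∀ {m n} → ¬ (m < n) → (m <ᵇ n) ≡ false
  ≮⇒<ᵇ-false {m} {n} m≮n = ¬T⇒≡false (λ t → m≮n (<ᵇ⇒< m n t))

  count : {A : Set} → (A → Bool) → List A → ℕ
  count p []       = 0
  count p (x ∷ xs) = 𝟙 (p x) + count p xs

  count-++ : ∀ {A : Set} (p : A → Bool) xs ys → count p (xs ++ ys) ≡ count p xs + count p ys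
  count-++ p []       ys = refl
  count-++ p (x ∷ xs) ys = trans (cong (𝟙 (p x) +_) (count-++ p xs ys)) (sym (+-assoc (𝟙 (p x)) _ _))

  count-map : ∀ {A B : Set} (p : B → Bool) (f : A → B) xs → count p (map f xs) ≡ count (λ x → p (f x)) xs
  count-map p f []       = refl
  count-map p f (x ∷ xs) = cong (𝟙 (p (f x)) +_) (count-map p f xs)

  count-↭ : ∀ {A : Set} (p : A → Bool) {xs ys} → xs ↭ ys → count p xs ≡ count p ys
  count-↭ p ↭.refl          = refl
  count-↭ p (↭.prep x q)    = cong (𝟙 (p x) +_) (count-↭ p q)
  count-↭ p (↭.swap x y q)  = trans (x∙yz≈y∙xz (𝟙 (p x)) (𝟙 (p y)) _) (cong (λ n → 𝟙 (p y) + (𝟙 (p x) + n)) (count-↭ p q))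
  count-↭ p (↭.trans q r)   = trans (count-↭ p q) (count-↭ p r)

  count-cong : ∀ {A : Set} {p q : A → Bool} → (∀ x → p x ≡ q x) → ∀ xs → count p xs ≡ count q xs
  count-cong e []       = refl
  count-cong e (x ∷ xs) = cong₂ _+_ (cong 𝟙 (e x)) (count-cong e xs)

  count-mono : ∀ {A : Set} {p q : A → Bool} → (∀ x → T (p x) → T (q x)) → ∀ xs → count p xs ≤ count q xs
  count-mono f []       = z≤n
  count-mono f (x ∷ xs) = +-mono-≤ (𝟙-mono (f x)) (count-mono f xs)

  count-true : ∀ {A : Set} (xs : List A) → count (λ _ → true) xs ≡ length xs
  count-true []       = refl
  count-true (x ∷ xs) = cong suc (count-true xs)

  occ : ℕ → List ℕ → ℕ
  occ y = count (y ≡ᵇ_)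

  Mem : ℕ → List ℕ → Set
  Mem y xs = 0 < occ y xs

  Distinct : List ℕ → Set
  Distinct xs = ∀ y → occ y xs ≤ 1

  Mem-head : ∀ x xs → Mem x (x ∷ xs)
  Mem-head x xs = subst (λ b → 0 < 𝟙 b + occ x xs) (sym (≡ᵇ-refl x)) (s≤s z≤n)

  Mem-tail : ∀ {y} x xs → Mem y xs → Mem y (x ∷ xs)
  Mem-tail {y} x xs m = ≤-trans m (m≤n+m (occ y xs) (𝟙 (y ≡ᵇ x)))

  Mem-inv : ∀ {y} x xs → Mem y (x ∷ xs) → y ≡ x ⊎ Mem y xs
  Mem-inv {y} x xs m with y ≟ x
  ... | yes e  = inj₁ e
  ... | no y≢x rewrite ≢⇒≡ᵇ-false y x y≢x = inj₂ m

  Mem-++ˡ : ∀ {y} xs ys → Mem y xs → Mem y (xs ++ ys)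
  Mem-++ˡ {y} xs ys m rewrite count-++ (y ≡ᵇ_) xs ys = ≤-trans m (m≤m+n _ _)

  Mem-++ʳ : ∀ {y} xs ys → Mem y ys → Mem y (xs ++ ys)
  Mem-++ʳ {y} xs ys m rewrite count-++ (y ≡ᵇ_) xs ys = ≤-trans m (m≤n+m _ _)

  ¬Mem⇒occ≡0 : ∀ y xs → ¬ Mem y xs → occ y xs ≡ 0
  ¬Mem⇒occ≡0 y xs ∉ with occ y xs
  ... | zero  = refl
  ... | suc _ = ⊥-elim (∉ (s≤s z≤n))

  Mem-++⁻ : ∀ {y} xs ys → Mem y (xs ++ ys) → Mem y xs ⊎ Mem y ys
  Mem-++⁻ {y} xs ys m with 0 <? occ y xs
  ... | yes p = inj₁ p
  ... | no ¬p rewrite count-++ (y ≡ᵇ_) xs ys | ¬Mem⇒occ≡0 y xs ¬p = inj₂ m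

  Distinct⇒occ≡1 : ∀ {y xs} → Distinct xs → Mem y xs → occ y xs ≡ 1
  Distinct⇒occ≡1 {y} d m = ≤-antisym (d y) m

  count-cong-Mem : ∀ {p q : ℕ → Bool} xs → (∀ x → Mem x xs → p x ≡ q x) → count p xs ≡ count q xs
  count-cong-Mem []       e = refl
  count-cong-Mem (x ∷ xs) e =
    cong₂ _+_ (cong 𝟙 (e x (Mem-head x xs))) (count-cong-Mem xs (λ y m → e y (Mem-tail {y} x xs m)))

  maximum : List ℕ → ℕ
  maximum []       = 0
  maximum (x ∷ xs) = x ⊔ maximum xs

  Mem⇒≤maximum : ∀ {y} xs → Mem y xs → y ≤ maximum xs
  Mem⇒≤maximum {y} (x ∷ xs) m with Mem-inv {y} x xs m
  ... | inj₁ refl = m≤m⊔n y (maximum xs)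
  ... | inj₂ m′   = ≤-trans (Mem⇒≤maximum xs m′) (m≤n⊔m x (maximum xs))

  Mem-split : ∀ x ys → Mem x ys → Σ (List ℕ) λ as → Σ (List ℕ) λ bs → ys ≡ as ++ x ∷ bs
  Mem-split x (y ∷ ys) m with Mem-inv {x} y ys m
  ... | inj₁ refl = [] , ys , refl
  ... | inj₂ m′ with Mem-split x ys m′
  ... | as , bs , refl = y ∷ as , bs , refl

  occ-middle : ∀ r as x bs → occ r (as ++ x ∷ bs) ≡ 𝟙 (r ≡ᵇ x) + occ r (as ++ bs)
  occ-middle r as x bs = begin
    count (r ≡ᵇ_) (as ++ x ∷ bs)                           ≡⟨ count-++ (r ≡ᵇ_) as (x ∷ bs) ⟩
    count (r ≡ᵇ_) as + (𝟙 (r ≡ᵇ x) + count (r ≡ᵇ_) bs)   ≡⟨ x∙yz≈y∙xz (count (r ≡ᵇ_) as) (𝟙 (r ≡ᵇ x)) _ ⟩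
    𝟙 (r ≡ᵇ x) + (count (r ≡ᵇ_) as + count (r ≡ᵇ_) bs)   ≡⟨ cong (𝟙 (r ≡ᵇ x) +_) (sym (count-++ (r ≡ᵇ_) as bs)) ⟩
    𝟙 (r ≡ᵇ x) + occ r (as ++ bs)                         ∎
    where open ≡-Reasoning

  occ⇒↭ : ∀ xs ys → (∀ r → occ r xs ≡ occ r ys) → xs ↭ ys
  occ⇒↭ []       []       e = ↭.refl
  occ⇒↭ []       (y ∷ ys) e = ⊥-elim (<-irrefl (e y) (Mem-head y ys))
  occ⇒↭ (x ∷ xs) ys       e with Mem-split x ys (subst (0 <_) (e x) (Mem-head x xs))
  ... | as , bs , refl =
    ↭.trans (↭.prep x (occ⇒↭ xs (as ++ bs) λ r → +-cancelˡ-≡ (𝟙 (r ≡ᵇ x)) _ _ (trans (e r) (occ-middle r as x bs))))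
            (↭-sym (shift x as bs))

  -- Sums over initial segments of ℕ

  sumBelow : (ℕ → ℕ) → ℕ → ℕ
  sumBelow f zero    = 0
  sumBelow f (suc n) = sumBelow f n + f n

  sumBelow-cong : ∀ {f g} n → (∀ i → i < n → f i ≡ g i) → sumBelow f n ≡ sumBelow g n
  sumBelow-cong zero    e = refl
  sumBelow-cong (suc n) e = cong₂ _+_ (sumBelow-cong n (λ i p → e i (m≤n⇒m≤1+n p))) (e n ≤-refl)

  sumBelow-mono : ∀ {f g} n → (∀ i → i < n → f i ≤ g i) → sumBelow f n ≤ sumBelow g n
  sumBelow-mono zero    e = z≤n
  sumBelow-mono (suc n) e = +-mono-≤ (sumBelow-mono n (λ i p → e i (m≤n⇒m≤1+n p))) (e n ≤-refl)

  sumBelow-+ : ∀ f g n → sumBelow (λ i → f i + g i) n ≡ sumBelow f n + sumBelow g n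
  sumBelow-+ f g zero    = refl
  sumBelow-+ f g (suc n) = trans (cong (_+ (f n + g n)) (sumBelow-+ f g n)) (interchange (sumBelow f n) (sumBelow g n) (f n) (g n))

  sumBelow-* : ∀ c f n → sumBelow (λ i → c * f i) n ≡ c * sumBelow f n
  sumBelow-* c f zero    = sym (*-zeroʳ c)
  sumBelow-* c f (suc n) = trans (cong (_+ c * f n) (sumBelow-* c f n)) (sym (*-distribˡ-+ c (sumBelow f n) (f n)))

  sumBelow-zero : ∀ n → sumBelow (λ _ → 0) n ≡ 0
  sumBelow-zero zero    = refl
  sumBelow-zero (suc n) = trans (+-identityʳ _) (sumBelow-zero n)

  +-≤-≡⇒≡ : ∀ {a b c d} → a ≤ b → c ≤ d → a + c ≡ b + d → a ≡ b × c ≡ d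
  +-≤-≡⇒≡ {a} {b} {c} {d} a≤b c≤d e with m≤n⇒m<n∨m≡n a≤b
  ... | inj₂ refl = refl , +-cancelˡ-≡ a c d e
  ... | inj₁ a<b  = ⊥-elim (<⇒≢ (+-mono-<-≤ a<b c≤d) e)

  sumBelow-≤-≡⇒≡ : ∀ {f g} n → (∀ i → i < n → f i ≤ g i) → sumBelow f n ≡ sumBelow g n → ∀ i → i < n → f i ≡ g i
  sumBelow-≤-≡⇒≡ (suc n) f≤g e i i<1+n with +-≤-≡⇒≡ (sumBelow-mono n (λ j q → f≤g j (m≤n⇒m≤1+n q))) (f≤g n ≤-refl) e
  ... | e₁ , e₂ with m≤n⇒m<n∨m≡n i<1+n
  ... | inj₂ refl     = e₂
  ... | inj₁ (s≤s i<n) = sumBelow-≤-≡⇒≡ n (λ j q → f≤g j (m≤n⇒m≤1+n q)) e₁ i i<n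

  sumBelow-indicator : ∀ v n → sumBelow (λ i → 𝟙 (v ≡ᵇ i)) n ≡ 𝟙 (v <ᵇ n)
  sumBelow-indicator v zero = cong 𝟙 (sym (≮⇒<ᵇ-false {v} {0} (λ ())))
  sumBelow-indicator v (suc n) rewrite sumBelow-indicator v n with <-cmp v n
  ... | tri< v<n v≢n _ rewrite <⇒<ᵇ-true v<n | ≢⇒≡ᵇ-false v n v≢n | <⇒<ᵇ-true (m≤n⇒m≤1+n v<n) = refl
  ... | tri≈ v≮n refl _ rewrite ≮⇒<ᵇ-false v≮n | ≡ᵇ-refl v | <⇒<ᵇ-true (n<1+n v) = refl
  ... | tri> v≮n v≢n _ rewrite ≮⇒<ᵇ-false v≮n | ≢⇒≡ᵇ-false v n v≢n
                             | ≮⇒<ᵇ-false {v} {suc n} (λ q → v≮n (≤∧≢⇒< (≤-pred q) v≢n)) = refl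

  sumBelow-occ : ∀ T X → (∀ x → Mem x X → x < T) → sumBelow (λ y → occ y X) T ≡ length X
  sumBelow-occ T []      b = sumBelow-zero T
  sumBelow-occ T (x ∷ X) b = trans (sumBelow-+ _ _ T) (cong₂ _+_ indicator (sumBelow-occ T X (λ y m → b y (Mem-tail {y} x X m))))
    where
    indicator : sumBelow (λ y → 𝟙 (y ≡ᵇ x)) T ≡ 1
    indicator = trans (sumBelow-cong T (λ i _ → cong 𝟙 (≡ᵇ-sym i x)))
                      (trans (sumBelow-indicator x T) (cong 𝟙 (<⇒<ᵇ-true (b x (Mem-head x X)))))

  sumBelow-<ᵇ-small : ∀ x T → T ≤ x → sumBelow (λ t → 𝟙 (x <ᵇ t)) T ≡ 0
  sumBelow-<ᵇ-small x zero    T≤x = refl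
  sumBelow-<ᵇ-small x (suc T) T≤x
    rewrite sumBelow-<ᵇ-small x T (≤-trans (n≤1+n T) T≤x) | ≮⇒<ᵇ-false {x} {T} (λ x<T → <-irrefl refl (<-≤-trans x<T (≤-trans (n≤1+n T) T≤x))) = refl

  sumBelow-<ᵇ : ∀ x T → x < T → sumBelow (λ t → 𝟙 (x <ᵇ t)) T + suc x ≡ T
  sumBelow-<ᵇ x (suc T) x<1+T with m≤n⇒m<n∨m≡n (≤-pred x<1+T)
  ... | inj₁ x<T rewrite <⇒<ᵇ-true x<T =
    trans (cong (_+ suc x) (+-comm (sumBelow (λ t → 𝟙 (x <ᵇ t)) T) 1)) (cong suc (sumBelow-<ᵇ x T x<T))
  ... | inj₂ refl rewrite sumBelow-<ᵇ-small x x ≤-refl | ≮⇒<ᵇ-false {x} {x} (<-irrefl refl) = refl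

  sumBelow-count-<ᵇ : ∀ T X → (∀ x → Mem x X → x < T) →
    sumBelow (λ t → count (_<ᵇ t) X) T + (sum X + length X) ≡ T * length X
  sumBelow-count-<ᵇ T []      b = trans (+-identityʳ _) (trans (sumBelow-zero T) (sym (*-zeroʳ T)))
  sumBelow-count-<ᵇ T (x ∷ X) b = begin
      sumBelow (λ t → 𝟙 (x <ᵇ t) + count (_<ᵇ t) X) T + (x + sum X + suc (length X))
        ≡⟨ cong (_+ (x + sum X + suc (length X))) (sumBelow-+ _ _ T) ⟩
      (A₁ + A₂) + (x + sum X + suc (length X))
        ≡⟨ rearrange A₁ A₂ x (sum X) (length X) ⟩
      (A₁ + suc x) + (A₂ + (sum X + length X))
        ≡⟨ cong₂ _+_ (sumBelow-<ᵇ x T (b x (Mem-head x X))) (sumBelow-count-<ᵇ T X (λ y m → b y (Mem-tail {y} x X m))) ⟩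
      T + T * length X
        ≡⟨ sym (*-suc T (length X)) ⟩
      T * suc (length X) ∎
    where
    open ≡-Reasoning
    open +-*-Solver
    A₁ = sumBelow (λ t → 𝟙 (x <ᵇ t)) T
    A₂ = sumBelow (λ t → count (_<ᵇ t) X) T
    rearrange : ∀ p q r s l → (p + q) + (r + s + suc l) ≡ (p + suc r) + (q + (s + l))
    rearrange = solve 5 (λ p q r s l → (p :+ q) :+ (r :+ s :+ (con 1 :+ l)) := (p :+ (con 1 :+ r)) :+ (q :+ (s :+ l))) refl

  <1+maximum-++ˡ : ∀ {x} X Y → Mem x X → x < suc (maximum (X ++ Y))
  <1+maximum-++ˡ {x} X Y m = s≤s (Mem⇒≤maximum (X ++ Y) (Mem-++ˡ {x} X Y m))

  <1+maximum-++ʳ : ∀ {x} X Y → Mem x Y → x < suc (maximum (X ++ Y))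
  <1+maximum-++ʳ {x} X Y m = s≤s (Mem⇒≤maximum (X ++ Y) (Mem-++ʳ {x} X Y m))

  occ≤-length≤⇒occ≡ : ∀ P Q → (∀ z → occ z P ≤ occ z Q) → length Q ≤ length P → ∀ y → occ y P ≡ occ y Q
  occ≤-length≤⇒occ≡ P Q occ≤ |Q|≤|P| y with y <? suc (maximum (P ++ Q))
  ... | yes y<b = sumBelow-≤-≡⇒≡ bound (λ z _ → occ≤ z) (≤-antisym (sumBelow-mono bound (λ z _ → occ≤ z)) Σocc-Q≤Σocc-P) y y<b
    where
    bound = suc (maximum (P ++ Q))
    Σocc-Q≤Σocc-P : sumBelow (λ z → occ z Q) bound ≤ sumBelow (λ z → occ z P) bound
    Σocc-Q≤Σocc-P = begin
      sumBelow (λ z → occ z Q) bound  ≡⟨ sumBelow-occ bound Q (λ x → <1+maximum-++ʳ P Q) ⟩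
      length Q                        ≤⟨ |Q|≤|P| ⟩
      length P                        ≡⟨ sumBelow-occ bound P (λ x → <1+maximum-++ˡ P Q) ⟨
      sumBelow (λ z → occ z P) bound  ∎
      where open ≤-Reasoning
  ... | no y≮b = trans (¬Mem⇒occ≡0 y P (λ m → y≮b (<1+maximum-++ˡ P Q m))) (sym (¬Mem⇒occ≡0 y Q (λ m → y≮b (<1+maximum-++ʳ P Q m))))

  occ-++-split : ∀ P₁ P₂ Q₁ Q₂ → Distinct Q₁ → (∀ x → Mem x P₂ → Mem x P₁) → length Q₁ ≡ length P₁ →
    (∀ y → occ y (Q₁ ++ Q₂) ≡ occ y (P₁ ++ P₂)) → ∀ y → occ y Q₁ ≡ occ y P₁ × occ y Q₂ ≡ occ y P₂
  occ-++-split P₁ P₂ Q₁ Q₂ dQ₁ P₂⊆P₁ |Q₁|≡|P₁| same y = first y , second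
    where
    first≤ : ∀ y → occ y Q₁ ≤ occ y P₁
    first≤ y with 0 <? occ y P₁
    ... | yes y∈P₁ = ≤-trans (dQ₁ y) y∈P₁
    ... | no  y∉P₁ = begin
      occ y Q₁                   ≤⟨ m≤m+n (occ y Q₁) (occ y Q₂) ⟩
      occ y Q₁ + occ y Q₂        ≡⟨ count-++ (y ≡ᵇ_) Q₁ Q₂ ⟨
      occ y (Q₁ ++ Q₂)           ≡⟨ same y ⟩
      occ y (P₁ ++ P₂)           ≡⟨ count-++ (y ≡ᵇ_) P₁ P₂ ⟩
      occ y P₁ + occ y P₂        ≡⟨ cong₂ _+_ (¬Mem⇒occ≡0 y P₁ y∉P₁) (¬Mem⇒occ≡0 y P₂ (λ m → y∉P₁ (P₂⊆P₁ y m))) ⟩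
      0                          ≡⟨ ¬Mem⇒occ≡0 y P₁ y∉P₁ ⟨
      occ y P₁                   ∎
      where open ≤-Reasoning
    first : ∀ y → occ y Q₁ ≡ occ y P₁
    first = occ≤-length≤⇒occ≡ Q₁ P₁ first≤ (≤-reflexive (sym |Q₁|≡|P₁|))
    second : occ y Q₂ ≡ occ y P₂
    second = +-cancelˡ-≡ (occ y P₁) _ _ (begin
      occ y P₁ + occ y Q₂        ≡⟨ cong (_+ occ y Q₂) (first y) ⟨
      occ y Q₁ + occ y Q₂        ≡⟨ count-++ (y ≡ᵇ_) Q₁ Q₂ ⟨
      occ y (Q₁ ++ Q₂)           ≡⟨ same y ⟩
      occ y (P₁ ++ P₂)           ≡⟨ count-++ (y ≡ᵇ_) P₁ P₂ ⟩
      occ y P₁ + occ y P₂        ∎)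
      where open ≡-Reasoning

  -- β-numbers and contents

  row : ℕ → ℕ → List ℕ
  row v zero    = []
  row v (suc x) = suc v ∷ row (suc v) x

  -- For a partition w padded to n parts, the integers y with c - n + y the contents of its
  -- nodes, listed row by row: row i (from the top) contributes y = (n - i) + b for 1 ≤ b ≤ wᵢ.
  rows : List ℕ → List ℕ
  rows []       = []
  rows (x ∷ xs) = row (length xs) x ++ rows xs

  beta : List ℕ → List ℕ
  beta []       = []
  beta (x ∷ xs) = (x + length xs) ∷ beta xs

  length-row : ∀ v x → length (row v x) ≡ x
  length-row v zero    = refl
  length-row v (suc x) = cong suc (length-row (suc v) x)

  length-beta : ∀ w → length (beta w) ≡ length w
  length-beta []       = refl
  length-beta (x ∷ xs) = cong suc (length-beta xs)

  length-rows+sum-downFrom : ∀ w → length (rows w) + sum (downFrom (length w)) ≡ sum (beta w)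
  length-rows+sum-downFrom []       = refl
  length-rows+sum-downFrom (x ∷ xs) = begin
    length (row L x ++ rows xs) + (L + sum (downFrom L))  ≡⟨ cong (_+ (L + sum (downFrom L))) (length-++ (row L x)) ⟩
    length (row L x) + length (rows xs) + (L + sum (downFrom L))
                                                           ≡⟨ cong (λ n → n + length (rows xs) + (L + sum (downFrom L))) (length-row L x) ⟩
    x + length (rows xs) + (L + sum (downFrom L))          ≡⟨ interchange x (length (rows xs)) L (sum (downFrom L)) ⟩
    x + L + (length (rows xs) + sum (downFrom L))          ≡⟨ cong (x + L +_) (length-rows+sum-downFrom xs) ⟩
    x + L + sum (beta xs)                                  ∎
    where
    open ≡-Reasoning
    L = length xs

  𝟙≡ᵇ+𝟙<ᵇ : ∀ r s → 𝟙 (r ≡ᵇ s) + 𝟙 (r <ᵇ s) ≡ 𝟙 (r <ᵇ suc s)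
  𝟙≡ᵇ+𝟙<ᵇ r s with <-cmp r s
  ... | tri< r<s r≢s _ rewrite ≢⇒≡ᵇ-false r s r≢s | <⇒<ᵇ-true r<s | <⇒<ᵇ-true (m≤n⇒m≤1+n r<s) = refl
  ... | tri≈ _ refl _  rewrite ≡ᵇ-refl r | ≮⇒<ᵇ-false {r} {r} (<-irrefl refl) | <⇒<ᵇ-true (n<1+n r) = refl
  ... | tri> r≮s r≢s _ rewrite ≢⇒≡ᵇ-false r s r≢s | ≮⇒<ᵇ-false r≮s
                             | ≮⇒<ᵇ-false {r} {suc s} (λ q → r≮s (≤∧≢⇒< (≤-pred q) r≢s)) = refl

  occ-row : ∀ r v x → occ r (row v x) + 𝟙 (r <ᵇ suc v) ≡ 𝟙 (r <ᵇ suc (x + v))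
  occ-row r v zero    = refl
  occ-row r v (suc x) = begin
      𝟙 (r ≡ᵇ suc v) + occ r (row (suc v) x) + 𝟙 (r <ᵇ suc v)   ≡⟨ xy∙z≈y∙xz (𝟙 (r ≡ᵇ suc v)) _ _ ⟩
      occ r (row (suc v) x) + (𝟙 (r ≡ᵇ suc v) + 𝟙 (r <ᵇ suc v)) ≡⟨ cong (occ r (row (suc v) x) +_) (𝟙≡ᵇ+𝟙<ᵇ r (suc v)) ⟩
      occ r (row (suc v) x) + 𝟙 (r <ᵇ suc (suc v))               ≡⟨ occ-row r (suc v) x ⟩
      𝟙 (r <ᵇ suc (x + suc v))                                   ≡⟨ cong (λ z → 𝟙 (r <ᵇ suc z)) (+-suc x v) ⟩
      𝟙 (r <ᵇ suc (suc x + v))                                   ∎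
    where open ≡-Reasoning

  occ-rows : ∀ r w → occ r (rows w) + count (λ z → r <ᵇ suc z) (downFrom (length w)) ≡ count (λ z → r <ᵇ suc z) (beta w)
  occ-rows r []       = refl
  occ-rows r (x ∷ xs) = begin
      occ r (row L x ++ rows xs) + (𝟙 (r <ᵇ suc L) + count p (downFrom L))
        ≡⟨ cong (_+ (𝟙 (r <ᵇ suc L) + count p (downFrom L))) (count-++ (r ≡ᵇ_) (row L x) (rows xs)) ⟩
      occ r (row L x) + occ r (rows xs) + (𝟙 (r <ᵇ suc L) + count p (downFrom L))
        ≡⟨ interchange (occ r (row L x)) _ _ _ ⟩
      (occ r (row L x) + 𝟙 (r <ᵇ suc L)) + (occ r (rows xs) + count p (downFrom L))
        ≡⟨ cong₂ _+_ (occ-row r L x) (occ-rows r xs) ⟩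
      𝟙 (r <ᵇ suc (x + L)) + count p (beta xs) ∎
    where
    open ≡-Reasoning
    L = length xs
    p = λ z → r <ᵇ suc z

  All-Mem : ∀ {P : ℕ → Set} {y} xs → All P xs → Mem y xs → P y
  All-Mem {y = y} (x ∷ xs) (px ∷ pxs) m with Mem-inv {y} x xs m
  ... | inj₁ refl = px
  ... | inj₂ m′   = All-Mem xs pxs m′

  Mem⇒All : ∀ {P : ℕ → Set} xs → (∀ y → Mem y xs → P y) → All P xs
  Mem⇒All []       f = []
  Mem⇒All (x ∷ xs) f = f x (Mem-head x xs) ∷ Mem⇒All xs (λ y m → f y (Mem-tail {y} x xs m))

  AllPairs>⇒Distinct : ∀ {xs} → AllPairs _>_ xs → Distinct xs
  AllPairs>⇒Distinct {[]}     []           y = z≤n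
  AllPairs>⇒Distinct {x ∷ xs} (x>xs ∷ sxs) y with y ≟ x
  ... | yes refl rewrite ≡ᵇ-refl y | ¬Mem⇒occ≡0 y xs (λ m → <-irrefl refl (All-Mem xs x>xs m)) = ≤-refl
  ... | no y≢x   rewrite ≢⇒≡ᵇ-false y x y≢x = AllPairs>⇒Distinct sxs y

  AllPairs>-occ-injective : ∀ {xs ys} → AllPairs _>_ xs → AllPairs _>_ ys → (∀ y → occ y xs ≡ occ y ys) → xs ≡ ys
  AllPairs>-occ-injective {[]}     {[]}     _ _ e = refl
  AllPairs>-occ-injective {[]}     {y ∷ ys} _ _ e = ⊥-elim (<-irrefl (e y) (Mem-head y ys))
  AllPairs>-occ-injective {x ∷ xs} {[]}     _ _ e = ⊥-elim (<-irrefl (sym (e x)) (Mem-head x xs))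
  AllPairs>-occ-injective {x ∷ xs} {y ∷ ys} (x>xs ∷ sxs) (y>ys ∷ sys) e
    with Mem-inv {x} y ys (subst (0 <_) (e x) (Mem-head x xs)) | Mem-inv {y} x xs (subst (0 <_) (sym (e y)) (Mem-head y ys))
  ... | inj₁ refl | _         = cong (x ∷_) (AllPairs>-occ-injective sxs sys (λ z → +-cancelˡ-≡ (𝟙 (z ≡ᵇ x)) _ _ (e z)))
  ... | inj₂ _    | inj₁ refl = cong (x ∷_) (AllPairs>-occ-injective sxs sys (λ z → +-cancelˡ-≡ (𝟙 (z ≡ᵇ x)) _ _ (e z)))
  ... | inj₂ x∈ys | inj₂ y∈xs = ⊥-elim (<-asym (All-Mem ys y>ys x∈ys) (All-Mem xs x>xs y∈xs))

  beta-below : ∀ x xs → Linked _≥_ (x ∷ xs) → All (x + length xs >_) (beta xs)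
  beta-below x []       _            = []
  beta-below x (y ∷ ys) (x≥y ∷ decr) = y+|ys|<x+1+|ys| ∷ All.map (λ z<· → <-≤-trans z<· (<⇒≤ y+|ys|<x+1+|ys|)) (beta-below y ys decr)
    where
    y+|ys|<x+1+|ys| : y + length ys < x + suc (length ys)
    y+|ys|<x+1+|ys| = subst (y + length ys <_) (sym (+-suc x (length ys))) (s≤s (+-monoˡ-≤ (length ys) x≥y))

  beta-strictlyDecreasing : ∀ {w} → Linked _≥_ w → AllPairs _>_ (beta w)
  beta-strictlyDecreasing {[]}     _    = []
  beta-strictlyDecreasing {x ∷ xs} decr = beta-below x xs decr ∷ beta-strictlyDecreasing (Linked.tail decr)

  beta-injective : ∀ w w′ → length w ≡ length w′ → beta w ≡ beta w′ → w ≡ w′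
  beta-injective []       []       _ _ = refl
  beta-injective (x ∷ xs) (y ∷ ys) |w|≡|w′| e =
    cong₂ _∷_ (+-cancelʳ-≡ (length xs) x y (trans (∷-injectiveˡ e) (cong (y +_) (sym |xs|≡|ys|))))
              (beta-injective xs ys |xs|≡|ys| (∷-injectiveʳ e))
    where |xs|≡|ys| = suc-injective |w|≡|w′|

  unbeta : List ℕ → List ℕ
  unbeta []       = []
  unbeta (p ∷ ps) = (p ∸ length ps) ∷ unbeta ps

  length-unbeta : ∀ P → length (unbeta P) ≡ length P
  length-unbeta []       = refl
  length-unbeta (p ∷ ps) = cong suc (length-unbeta ps)

  AllPairs>-length≤head : ∀ p ps → AllPairs _>_ (p ∷ ps) → length ps ≤ p
  AllPairs>-length≤head p []       _                  = z≤n
  AllPairs>-length≤head p (q ∷ qs) ((p>q ∷ _) ∷ sqs) = ≤-trans (s≤s (AllPairs>-length≤head q qs sqs)) p>q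

  beta-unbeta : ∀ {P} → AllPairs _>_ P → beta (unbeta P) ≡ P
  beta-unbeta {[]}     _ = refl
  beta-unbeta {p ∷ ps} s@(_ ∷ sps) =
    cong₂ _∷_ (trans (cong ((p ∸ length ps) +_) (length-unbeta ps)) (m∸n+n≡m (AllPairs>-length≤head p ps s))) (beta-unbeta sps)

  unbeta-decreasing : ∀ {P} → AllPairs _>_ P → Linked _≥_ (unbeta P)
  unbeta-decreasing {[]}           _ = []
  unbeta-decreasing {p ∷ []}       _ = [-]
  unbeta-decreasing {zero ∷ q ∷ qs} ((() ∷ _) ∷ _)
  unbeta-decreasing {suc p ∷ q ∷ qs} ((q<1+p ∷ _) ∷ s) = ∸-monoˡ-≤ (length qs) (≤-pred q<1+p) ∷ unbeta-decreasing s

  pad : ℕ → List ℕ → List ℕ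
  pad n l = l ++ replicate (n ∸ length l) 0

  length-pad : ∀ n l → length l ≤ n → length (pad n l) ≡ n
  length-pad n l |l|≤n rewrite length-++ l {replicate (n ∸ length l) 0} | length-replicate (n ∸ length l) {0} = m+[n∸m]≡n |l|≤n

  zeros-decreasing : ∀ z → Linked _≥_ (replicate z 0)
  zeros-decreasing zero          = []
  zeros-decreasing (suc zero)    = [-]
  zeros-decreasing (suc (suc z)) = z≤n ∷ zeros-decreasing (suc z)

  ++-zeros-decreasing : ∀ l z → Linked _≥_ l → Linked _≥_ (l ++ replicate z 0)
  ++-zeros-decreasing []           z       _          = zeros-decreasing z
  ++-zeros-decreasing (x ∷ [])     zero    _          = [-]
  ++-zeros-decreasing (x ∷ [])     (suc z) _          = z≤n ∷ zeros-decreasing (suc z)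
  ++-zeros-decreasing (x ∷ y ∷ ys) z       (x≥y ∷ d) = x≥y ∷ ++-zeros-decreasing (y ∷ ys) z d

  prefix-decreasing : ∀ l r → Linked _≥_ (l ++ r) → Linked _≥_ l
  prefix-decreasing []           r _         = []
  prefix-decreasing (x ∷ [])     r _         = [-]
  prefix-decreasing (x ∷ y ∷ ys) r (x≥y ∷ d) = x≥y ∷ prefix-decreasing (y ∷ ys) r d

  pad-decreasing : ∀ n {l} → IsPartition l → Linked _≥_ (pad n l)
  pad-decreasing n {l} (_ , decr) = ++-zeros-decreasing l (n ∸ length l) decr

  dropZeros : List ℕ → List ℕ
  dropZeros []           = []
  dropZeros (zero ∷ xs)  = dropZeros xs
  dropZeros (suc x ∷ xs) = suc x ∷ dropZeros xs

  dropZeros-positive : ∀ w → All (0 <_) (dropZeros w)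
  dropZeros-positive []           = []
  dropZeros-positive (zero ∷ xs)  = dropZeros-positive xs
  dropZeros-positive (suc x ∷ xs) = s≤s z≤n ∷ dropZeros-positive xs

  length-dropZeros : ∀ w → length (dropZeros w) ≤ length w
  length-dropZeros []           = z≤n
  length-dropZeros (zero ∷ xs)  = m≤n⇒m≤1+n (length-dropZeros xs)
  length-dropZeros (suc x ∷ xs) = s≤s (length-dropZeros xs)

  decreasing-after-zero : ∀ xs → Linked _≥_ (0 ∷ xs) → xs ≡ replicate (length xs) 0
  decreasing-after-zero []           _         = refl
  decreasing-after-zero (zero ∷ ys)  (_ ∷ d)   = cong (0 ∷_) (decreasing-after-zero ys d)
  decreasing-after-zero (suc y ∷ ys) (() ∷ _)

  dropZeros-zeros : ∀ z → dropZeros (replicate z 0) ≡ []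
  dropZeros-zeros zero    = refl
  dropZeros-zeros (suc z) = dropZeros-zeros z

  pad-dropZeros : ∀ w → Linked _≥_ w → pad (length w) (dropZeros w) ≡ w
  pad-dropZeros []           _ = refl
  pad-dropZeros (zero ∷ xs)  d rewrite decreasing-after-zero xs d = zeros (length xs)
    where
    zeros : ∀ k → pad (suc (length (replicate k 0))) (dropZeros (replicate k 0)) ≡ 0 ∷ replicate k 0
    zeros k rewrite dropZeros-zeros k | length-replicate k {0} = refl
  pad-dropZeros (suc x ∷ xs) d = cong (suc x ∷_) (pad-dropZeros xs (Linked.tail d))

  dropZeros-decreasing : ∀ w → Linked _≥_ w → Linked _≥_ (dropZeros w)
  dropZeros-decreasing w d = prefix-decreasing (dropZeros w) _ (subst (Linked _≥_) (sym (pad-dropZeros w d)) d)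

  dropZeros-++ : ∀ l r → dropZeros (l ++ r) ≡ dropZeros l ++ dropZeros r
  dropZeros-++ []           r = refl
  dropZeros-++ (zero ∷ l)   r = dropZeros-++ l r
  dropZeros-++ (suc x ∷ l)  r = cong (suc x ∷_) (dropZeros-++ l r)

  dropZeros-positive-id : ∀ {l} → All (0 <_) l → dropZeros l ≡ l
  dropZeros-positive-id []                      = refl
  dropZeros-positive-id {suc x ∷ l} (_ ∷ pos) = cong (suc x ∷_) (dropZeros-positive-id pos)

  dropZeros-pad : ∀ n {l} → All (0 <_) l → dropZeros (pad n l) ≡ l
  dropZeros-pad n {l} pos rewrite dropZeros-++ l (replicate (n ∸ length l) 0) | dropZeros-zeros (n ∸ length l)
                                | dropZeros-positive-id pos = ++-identityʳ l

  remove : ℕ → List ℕ → List ℕ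
  remove y []       = []
  remove y (x ∷ xs) = if x ≡ᵇ y then remove y xs else x ∷ remove y xs

  count-remove : ∀ q y l → count q (remove y l) + 𝟙 (q y) * occ y l ≡ count q l
  count-remove q y []       = *-zeroʳ (𝟙 (q y))
  count-remove q y (x ∷ xs) with x ≡ᵇ y in eq
  ... | true rewrite ≡ᵇ⇒≡ x y (≡true⇒T eq) | ≡ᵇ-refl y = begin
      count q (remove y xs) + 𝟙 (q y) * suc (occ y xs)      ≡⟨ cong (count q (remove y xs) +_) (*-suc (𝟙 (q y)) (occ y xs)) ⟩
      count q (remove y xs) + (𝟙 (q y) + 𝟙 (q y) * occ y xs) ≡⟨ x∙yz≈y∙xz (count q (remove y xs)) (𝟙 (q y)) _ ⟩
      𝟙 (q y) + (count q (remove y xs) + 𝟙 (q y) * occ y xs) ≡⟨ cong (𝟙 (q y) +_) (count-remove q y xs) ⟩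
      𝟙 (q y) + count q xs                                    ∎
    where open ≡-Reasoning
  ... | false rewrite ≡ᵇ-sym y x | eq = trans (+-assoc (𝟙 (q x)) _ _) (cong (𝟙 (q x) +_) (count-remove q y xs))

  Mem-remove : ∀ {z} y l → Mem z (remove y l) → Mem z l
  Mem-remove {z} y l m = <-≤-trans m (≤-trans (m≤m+n _ _) (≤-reflexive (count-remove (z ≡ᵇ_) y l)))

  remove-strictlyDecreasing : ∀ y {l} → AllPairs _>_ l → AllPairs _>_ (remove y l)
  remove-strictlyDecreasing y {[]}     _            = []
  remove-strictlyDecreasing y {x ∷ xs} (x>xs ∷ sxs) with x ≡ᵇ y
  ... | true  = remove-strictlyDecreasing y sxs
  ... | false = Mem⇒All (remove y xs) (λ z m → All-Mem xs x>xs (Mem-remove {z} y xs m)) ∷ remove-strictlyDecreasing y sxs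

  length-remove : ∀ y l → Distinct l → Mem y l → suc (length (remove y l)) ≡ length l
  length-remove y l d y∈l = begin
      suc (length (remove y l))                          ≡⟨ +-comm 1 _ ⟩
      length (remove y l) + 1                            ≡⟨ cong₂ _+_ (sym (count-true (remove y l))) (sym (trans (+-identityʳ (occ y l)) (Distinct⇒occ≡1 {y} {l} d y∈l))) ⟩
      count (λ _ → true) (remove y l) + 1 * occ y l      ≡⟨ count-remove (λ _ → true) y l ⟩
      count (λ _ → true) l                               ≡⟨ count-true l ⟩
      length l                                           ∎
    where open ≡-Reasoning

  insert : ℕ → List ℕ → List ℕ
  insert x []       = x ∷ []
  insert x (y ∷ ys) = if y <ᵇ x then x ∷ y ∷ ys else y ∷ insert x ys

  count-insert : ∀ q x l → count q (insert x l) ≡ 𝟙 (q x) + count q l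
  count-insert q x []       = refl
  count-insert q x (y ∷ ys) with y <ᵇ x
  ... | true  = refl
  ... | false = trans (cong (𝟙 (q y) +_) (count-insert q x ys)) (x∙yz≈y∙xz (𝟙 (q y)) (𝟙 (q x)) (count q ys))

  length-insert : ∀ x l → length (insert x l) ≡ suc (length l)
  length-insert x l = trans (sym (count-true (insert x l))) (trans (count-insert (λ _ → true) x l) (cong suc (count-true l)))

  Mem-insert : ∀ x l → Mem x (insert x l)
  Mem-insert x l = subst (0 <_) (sym (count-insert (x ≡ᵇ_) x l)) (Mem-head x l)

  Mem-insert⁻ : ∀ {z} x l → Mem z (insert x l) → z ≡ x ⊎ Mem z l
  Mem-insert⁻ {z} x l m with z ≟ x
  ... | yes z≡x = inj₁ z≡x
  ... | no  z≢x = inj₂ (subst (0 <_) (trans (count-insert (z ≡ᵇ_) x l) (cong (λ b → 𝟙 b + occ z l) (≢⇒≡ᵇ-false z x z≢x))) m)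

  insert-strictlyDecreasing : ∀ x {l} → AllPairs _>_ l → ¬ Mem x l → AllPairs _>_ (insert x l)
  insert-strictlyDecreasing x {[]}     _            _   = [] ∷ []
  insert-strictlyDecreasing x {y ∷ ys} (y>ys ∷ sys) x∉l with y <ᵇ x in eq
  ... | true  = (y<x ∷ All.map (λ z<y → <-trans z<y y<x) y>ys) ∷ y>ys ∷ sys
    where y<x = <ᵇ⇒< y x (≡true⇒T eq)
  ... | false = Mem⇒All (insert x ys) below-y ∷ insert-strictlyDecreasing x sys (λ m → x∉l (Mem-tail {x} y ys m))
    where
    x<y : x < y
    x<y with <-cmp x y
    ... | tri< x<y _ _ = x<y
    ... | tri≈ _ refl _ = ⊥-elim (x∉l (Mem-head x ys))
    ... | tri> _ _ y<x rewrite <⇒<ᵇ-true y<x = case eq of λ ()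
    below-y : ∀ z → Mem z (insert x ys) → z < y
    below-y z m with Mem-insert⁻ {z} x ys m
    ... | inj₁ refl = x<y
    ... | inj₂ m′   = All-Mem ys y>ys m′

  applyUpTo-cong : ∀ {A : Set} {f g : ℕ → A} n → (∀ i → f i ≡ g i) → applyUpTo f n ≡ applyUpTo g n
  applyUpTo-cong zero    e = refl
  applyUpTo-cong (suc n) e = cong₂ _∷_ (e 0) (applyUpTo-cong n (λ i → e (suc i)))

  map-row : ∀ {A : Set} (F : ℕ → A) v x → map F (row v x) ≡ applyUpTo (λ i → F (v + suc i)) x
  map-row F v zero    = refl
  map-row F v (suc x) = cong₂ _∷_ (cong F (sym (trans (+-suc v 0) (cong suc (+-identityʳ v)))))
    (trans (map-row F (suc v) x) (applyUpTo-cong x (λ i → cong F (sym (+-suc v (suc i))))))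

  compContents-rows : ∀ c j l → compContents c (suc j) l ≡ map (λ y → (c ℤ.- ℤ.+ (j + length l)) ℤ.+ ℤ.+ y) (rows l)
  compContents-rows c j []       = refl
  compContents-rows c j (x ∷ xs) = trans (cong₂ _++_ first-row other-rows) (sym (map-++ _ (row (length xs) x) (rows xs)))
    where
    L = length xs
    M = c ℤ.- ℤ.+ (j + suc L)
    other-rows : compContents c (suc (suc j)) xs ≡ map (λ y → M ℤ.+ ℤ.+ y) (rows xs)
    other-rows = trans (compContents-rows c (suc j) xs) (map-cong (λ y → cong (λ u → (c ℤ.- ℤ.+ u) ℤ.+ ℤ.+ y) (sym (+-suc j L))) (rows xs))
    content-of-node : ∀ (I J L c : ℤ) → ((ℤ.+ 1 ℤ.+ I) ℤ.- (ℤ.+ 1 ℤ.+ J)) ℤ.+ c ≡ (c ℤ.- (J ℤ.+ (ℤ.+ 1 ℤ.+ L))) ℤ.+ (L ℤ.+ (ℤ.+ 1 ℤ.+ I))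
    content-of-node = solve-∀
    first-row : map (λ b → (ℤ.+ b ℤ.- ℤ.+ suc j) ℤ.+ c) (applyUpTo suc x) ≡ map (λ y → M ℤ.+ ℤ.+ y) (row L x)
    first-row = trans (map-applyUpTo suc _ x) (trans (applyUpTo-cong x node) (sym (map-row (λ y → M ℤ.+ ℤ.+ y) L x)))
      where
      node : ∀ i → (ℤ.+ suc i ℤ.- ℤ.+ suc j) ℤ.+ c ≡ M ℤ.+ ℤ.+ (L + suc i)
      node i rewrite ℤ.pos-+ j (suc L) | ℤ.pos-+ L (suc i) | ℤ.pos-+ 1 L | ℤ.pos-+ 1 i | ℤ.pos-+ 1 j =
        content-of-node (ℤ.+ i) (ℤ.+ j) (ℤ.+ L) c

  compContents-zeros : ∀ c i z → compContents c i (replicate z 0) ≡ []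
  compContents-zeros c i zero    = refl
  compContents-zeros c i (suc z) = compContents-zeros c (suc i) z

  compContents-++-zeros : ∀ c i l z → compContents c i (l ++ replicate z 0) ≡ compContents c i l
  compContents-++-zeros c i []      z = compContents-zeros c i z
  compContents-++-zeros c i (x ∷ l) z = cong (_ ++_) (compContents-++-zeros c (suc i) l z)

  compContents-pad : ∀ c n l → length l ≤ n → compContents c 1 l ≡ map (λ y → (c ℤ.- ℤ.+ n) ℤ.+ ℤ.+ y) (rows (pad n l))
  compContents-pad c n l |l|≤n =
    trans (sym (compContents-++-zeros c 1 l (n ∸ length l)))
          (trans (compContents-rows c 0 (pad n l))
                 (cong (λ u → map (λ y → (c ℤ.- ℤ.+ u) ℤ.+ ℤ.+ y) (rows (pad n l))) (length-pad n l |l|≤n)))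

  compContents-+ : ∀ c t i l → compContents (c ℤ.+ t) i l ≡ map (ℤ._+ t) (compContents c i l)
  compContents-+ c t i []      = refl
  compContents-+ c t i (x ∷ l) =
    trans (cong₂ _++_ (trans (map-cong (λ b → sym (ℤ.+-assoc (ℤ.+ b ℤ.- ℤ.+ i) c t)) (applyUpTo suc x)) (map-∘ (applyUpTo suc x)))
                      (compContents-+ c t (suc i) l))
          (sym (map-++ (ℤ._+ t) (map (λ b → (ℤ.+ b ℤ.- ℤ.+ i) ℤ.+ c) (applyUpTo suc x)) (compContents c (suc i) l)))

  content-rows : ∀ s c₁ c₂ n₁ n₂ l m → length l ≤ n₁ → length m ≤ n₂ → c₁ ℤ.- ℤ.+ n₁ ≡ c₂ ℤ.- ℤ.+ n₂ →
    content s c₁ c₂ (l , m) ≡ map (residue s) (map (λ y → (c₂ ℤ.- ℤ.+ n₂) ℤ.+ ℤ.+ y) (rows (pad n₁ l) ++ rows (pad n₂ m)))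
  content-rows s c₁ c₂ n₁ n₂ l m |l|≤n₁ |m|≤n₂ M≡ =
    cong (map (residue s))
      (trans (cong₂ _++_ (trans (compContents-pad c₁ n₁ l |l|≤n₁) (cong (λ M → map (λ y → M ℤ.+ ℤ.+ y) (rows (pad n₁ l))) M≡))
                         (compContents-pad c₂ n₂ m |m|≤n₂))
             (sym (map-++ _ (rows (pad n₁ l)) (rows (pad n₂ m)))))

  beads : ℕ → List ℕ → List ℕ
  beads n l = beta (pad n l)

  beads-strictlyDecreasing : ∀ n {l} → IsPartition l → AllPairs _>_ (beads n l)
  beads-strictlyDecreasing n p = beta-strictlyDecreasing (pad-decreasing n p)

  beads-distinct : ∀ n {l} → IsPartition l → Distinct (beads n l)
  beads-distinct n p = AllPairs>⇒Distinct (beads-strictlyDecreasing n p)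

  length-beads : ∀ n l → length l ≤ n → length (beads n l) ≡ n
  length-beads n l |l|≤n = trans (length-beta (pad n l)) (length-pad n l |l|≤n)

  beads-injective : ∀ n {l l′} → IsPartition l → IsPartition l′ → length l ≤ n → length l′ ≤ n → beads n l ≡ beads n l′ → l ≡ l′
  beads-injective n {l} {l′} (pos , _) (pos′ , _) |l|≤n |l′|≤n e = begin
    l                      ≡⟨ dropZeros-pad n pos ⟨
    dropZeros (pad n l)    ≡⟨ cong dropZeros (beta-injective (pad n l) (pad n l′) (trans (length-pad n l |l|≤n) (sym (length-pad n l′ |l′|≤n))) e) ⟩
    dropZeros (pad n l′)   ≡⟨ dropZeros-pad n pos′ ⟩
    l′                     ∎
    where open ≡-Reasoning

  partitionWithBeads : List ℕ → List ℕ
  partitionWithBeads P = dropZeros (unbeta P)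

  partitionWithBeads-isPartition : ∀ {P} → AllPairs _>_ P → IsPartition (partitionWithBeads P)
  partitionWithBeads-isPartition {P} s = dropZeros-positive (unbeta P) , dropZeros-decreasing (unbeta P) (unbeta-decreasing s)

  length-partitionWithBeads : ∀ P → length (partitionWithBeads P) ≤ length P
  length-partitionWithBeads P = ≤-trans (length-dropZeros (unbeta P)) (≤-reflexive (length-unbeta P))

  beads-partitionWithBeads : ∀ {P} → AllPairs _>_ P → beads (length P) (partitionWithBeads P) ≡ P
  beads-partitionWithBeads {P} s = begin
    beta (pad (length P) (dropZeros (unbeta P)))            ≡⟨ cong (λ n → beta (pad n (dropZeros (unbeta P)))) (length-unbeta P) ⟨
    beta (pad (length (unbeta P)) (dropZeros (unbeta P)))   ≡⟨ cong beta (pad-dropZeros (unbeta P) (unbeta-decreasing s)) ⟩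
    beta (unbeta P)                                         ≡⟨ beta-unbeta s ⟩
    P                                                       ∎
    where open ≡-Reasoning

  occ-rows-++ : ∀ r W₁ W₂ → let p = λ z → r <ᵇ suc z in
    occ r (rows W₁ ++ rows W₂) + (count p (downFrom (length W₁)) + count p (downFrom (length W₂))) ≡ count p (beta W₁ ++ beta W₂)
  occ-rows-++ r W₁ W₂ = begin
      occ r (rows W₁ ++ rows W₂) + (V₁ + V₂)               ≡⟨ cong (_+ (V₁ + V₂)) (count-++ (r ≡ᵇ_) (rows W₁) (rows W₂)) ⟩
      occ r (rows W₁) + occ r (rows W₂) + (V₁ + V₂)        ≡⟨ interchange (occ r (rows W₁)) _ _ _ ⟩
      (occ r (rows W₁) + V₁) + (occ r (rows W₂) + V₂)      ≡⟨ cong₂ _+_ (occ-rows r W₁) (occ-rows r W₂) ⟩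
      count p (beta W₁) + count p (beta W₂)                ≡⟨ count-++ p (beta W₁) (beta W₂) ⟨
      count p (beta W₁ ++ beta W₂)                         ∎
    where
    open ≡-Reasoning
    p = λ z → r <ᵇ suc z
    V₁ = count p (downFrom (length W₁))
    V₂ = count p (downFrom (length W₂))

  beta-↭⇒rows-↭ : ∀ W₁ W₂ W₁′ W₂′ → length W₁′ ≡ length W₁ → length W₂′ ≡ length W₂ →
    beta W₁′ ++ beta W₂′ ↭ beta W₁ ++ beta W₂ → rows W₁′ ++ rows W₂′ ↭ rows W₁ ++ rows W₂
  beta-↭⇒rows-↭ W₁ W₂ W₁′ W₂′ |W₁′| |W₂′| B′↭B = occ⇒↭ _ _ λ r → +-cancelʳ-≡ _ _ _ (begin
      occ r (rows W₁′ ++ rows W₂′) + (V r W₁ + V r W₂)    ≡⟨ cong₂ (λ u v → occ r (rows W₁′ ++ rows W₂′) + (V′ r u + V′ r v)) |W₁′| |W₂′| ⟨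
      occ r (rows W₁′ ++ rows W₂′) + (V r W₁′ + V r W₂′)  ≡⟨ occ-rows-++ r W₁′ W₂′ ⟩
      count (λ z → r <ᵇ suc z) (beta W₁′ ++ beta W₂′)     ≡⟨ count-↭ (λ z → r <ᵇ suc z) B′↭B ⟩
      count (λ z → r <ᵇ suc z) (beta W₁ ++ beta W₂)       ≡⟨ occ-rows-++ r W₁ W₂ ⟨
      occ r (rows W₁ ++ rows W₂) + (V r W₁ + V r W₂)      ∎)
    where
    open ≡-Reasoning
    V′ : ℕ → ℕ → ℕ
    V′ r n = count (λ z → r <ᵇ suc z) (downFrom n)
    V : ℕ → List ℕ → ℕ
    V r W = V′ r (length W)

  beads-↭⇒content-↭ : ∀ s c₁ c₂ n₁ n₂ l m l′ m′ → length l ≤ n₁ → length m ≤ n₂ → length l′ ≤ n₁ → length m′ ≤ n₂ →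
    c₁ ℤ.- ℤ.+ n₁ ≡ c₂ ℤ.- ℤ.+ n₂ → beads n₁ l′ ++ beads n₂ m′ ↭ beads n₁ l ++ beads n₂ m →
    content s c₁ c₂ (l′ , m′) ↭ content s c₁ c₂ (l , m)
  beads-↭⇒content-↭ s c₁ c₂ n₁ n₂ l m l′ m′ |l| |m| |l′| |m′| M≡ B′↭B
    rewrite content-rows s c₁ c₂ n₁ n₂ l′ m′ |l′| |m′| M≡ | content-rows s c₁ c₂ n₁ n₂ l m |l| |m| M≡ =
    map⁺ (residue s) (map⁺ _ (beta-↭⇒rows-↭ (pad n₁ l) (pad n₂ m) (pad n₁ l′) (pad n₂ m′)
      (trans (length-pad n₁ l′ |l′|) (sym (length-pad n₁ l |l|))) (trans (length-pad n₂ m′ |m′|) (sym (length-pad n₂ m |m|))) B′↭B))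

  sum-beta-++ : ∀ W₁ W₂ → sum (beta W₁) + sum (beta W₂) ≡ length (rows W₁ ++ rows W₂) + (sum (downFrom (length W₁)) + sum (downFrom (length W₂)))
  sum-beta-++ W₁ W₂ = begin
      sum (beta W₁) + sum (beta W₂)
        ≡⟨ cong₂ _+_ (length-rows+sum-downFrom W₁) (length-rows+sum-downFrom W₂) ⟨
      (length (rows W₁) + sum (downFrom (length W₁))) + (length (rows W₂) + sum (downFrom (length W₂)))
        ≡⟨ interchange (length (rows W₁)) _ _ _ ⟩
      (length (rows W₁) + length (rows W₂)) + (sum (downFrom (length W₁)) + sum (downFrom (length W₂)))
        ≡⟨ cong (_+ (sum (downFrom (length W₁)) + sum (downFrom (length W₂)))) (length-++ (rows W₁)) ⟨
      length (rows W₁ ++ rows W₂) + (sum (downFrom (length W₁)) + sum (downFrom (length W₂))) ∎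
    where open ≡-Reasoning

  Mem-all-or-missing : ∀ P L → (∀ y → Mem y L → Mem y P) ⊎ Σ ℕ (λ y → Mem y L × ¬ Mem y P)
  Mem-all-or-missing P []      = inj₁ (λ y ())
  Mem-all-or-missing P (z ∷ L) with 0 <? occ z P | Mem-all-or-missing P L
  ... | no  z∉P | _                   = inj₂ (z , Mem-head z L , z∉P)
  ... | yes _   | inj₂ (y , y∈L , y∉P) = inj₂ (y , Mem-tail {y} z L y∈L , y∉P)
  ... | yes z∈P | inj₁ L⊆P            = inj₁ (λ y m → [ (λ { refl → z∈P }) , L⊆P y ] (Mem-inv {y} z L m))

  ⊆-length⇒occ≡ : ∀ P Q → Distinct P → (∀ y → Mem y P → Mem y Q) → length Q ≤ length P → ∀ y → occ y P ≡ occ y Q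
  ⊆-length⇒occ≡ P Q dP P⊆Q = occ≤-length≤⇒occ≡ P Q occ≤
    where
    occ≤ : ∀ z → occ z P ≤ occ z Q
    occ≤ z with 0 <? occ z P
    ... | yes z∈P = ≤-trans (dP z) (P⊆Q z z∈P)
    ... | no  z∉P = ≤-trans (≤-reflexive (¬Mem⇒occ≡0 z P z∉P)) z≤n

  module _ (x y : ℕ) (P₁ P₂ : List ℕ) where

    exchanged₁ exchanged₂ : List ℕ
    exchanged₁ = insert x (remove y P₁)
    exchanged₂ = insert y (remove x P₂)

    exchanged₁-strictlyDecreasing : AllPairs _>_ P₁ → ¬ Mem x P₁ → AllPairs _>_ exchanged₁
    exchanged₁-strictlyDecreasing s x∉P₁ = insert-strictlyDecreasing x (remove-strictlyDecreasing y s) (λ m → x∉P₁ (Mem-remove {x} y P₁ m))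

    exchanged₂-strictlyDecreasing : AllPairs _>_ P₂ → ¬ Mem y P₂ → AllPairs _>_ exchanged₂
    exchanged₂-strictlyDecreasing s y∉P₂ = insert-strictlyDecreasing y (remove-strictlyDecreasing x s) (λ m → y∉P₂ (Mem-remove {y} x P₂ m))

    length-exchanged₁ : Distinct P₁ → Mem y P₁ → length exchanged₁ ≡ length P₁
    length-exchanged₁ d y∈P₁ = trans (length-insert x (remove y P₁)) (length-remove y P₁ d y∈P₁)

    length-exchanged₂ : Distinct P₂ → Mem x P₂ → length exchanged₂ ≡ length P₂
    length-exchanged₂ d x∈P₂ = trans (length-insert y (remove x P₂)) (length-remove x P₂ d x∈P₂)

    exchanged-↭ : Distinct P₁ → Distinct P₂ → Mem y P₁ → Mem x P₂ → exchanged₁ ++ exchanged₂ ↭ P₁ ++ P₂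
    exchanged-↭ d₁ d₂ y∈P₁ x∈P₂ = occ⇒↭ _ _ λ r → begin
        occ r (exchanged₁ ++ exchanged₂)                              ≡⟨ count-++ (r ≡ᵇ_) exchanged₁ exchanged₂ ⟩
        occ r exchanged₁ + occ r exchanged₂                           ≡⟨ cong₂ _+_ (count-insert (r ≡ᵇ_) x (remove y P₁)) (count-insert (r ≡ᵇ_) y (remove x P₂)) ⟩
        (𝟙 (r ≡ᵇ x) + occ r (remove y P₁)) + (𝟙 (r ≡ᵇ y) + occ r (remove x P₂))
                                                                      ≡⟨ rearrange (𝟙 (r ≡ᵇ x)) (occ r (remove y P₁)) (𝟙 (r ≡ᵇ y)) (occ r (remove x P₂)) ⟩
        (occ r (remove y P₁) + 𝟙 (r ≡ᵇ y) * 1) + (occ r (remove x P₂) + 𝟙 (r ≡ᵇ x) * 1)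
                                                                      ≡⟨ cong₂ (λ u v → (occ r (remove y P₁) + 𝟙 (r ≡ᵇ y) * u) + (occ r (remove x P₂) + 𝟙 (r ≡ᵇ x) * v))
                                                                               (Distinct⇒occ≡1 {y} {P₁} d₁ y∈P₁) (Distinct⇒occ≡1 {x} {P₂} d₂ x∈P₂) ⟨
        (occ r (remove y P₁) + 𝟙 (r ≡ᵇ y) * occ y P₁) + (occ r (remove x P₂) + 𝟙 (r ≡ᵇ x) * occ x P₂)
                                                                      ≡⟨ cong₂ _+_ (count-remove (r ≡ᵇ_) y P₁) (count-remove (r ≡ᵇ_) x P₂) ⟩
        occ r P₁ + occ r P₂                                           ≡⟨ count-++ (r ≡ᵇ_) P₁ P₂ ⟨
        occ r (P₁ ++ P₂)                                              ∎
      where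
      open ≡-Reasoning
      open +-*-Solver
      rearrange : ∀ p A q B → (p + A) + (q + B) ≡ (A + q * 1) + (B + p * 1)
      rearrange = solve 4 (λ p A q B → (p :+ A) :+ (q :+ B) := (A :+ q :* con 1) :+ (B :+ p :* con 1)) refl

  [c+k]-[n+k]≡c-n : ∀ c k n → (c ℤ.+ ℤ.+ k) ℤ.- ℤ.+ (n + k) ≡ c ℤ.- ℤ.+ n
  [c+k]-[n+k]≡c-n c k n rewrite ℤ.pos-+ n k = cancel c (ℤ.+ k) (ℤ.+ n)
    where
    cancel : ∀ (c k n : ℤ) → (c ℤ.+ k) ℤ.- (n ℤ.+ k) ≡ c ℤ.- n
    cancel = solve-∀

  module _ (c₂ : ℤ) (k N : ℕ) {l m : List ℕ} (pl : IsPartition l) (pm : IsPartition m)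
           (|l| : length l ≤ N + k) (|m| : length m ≤ N) where

    private
      P₁ = beads (N + k) l
      P₂ = beads N m
      s₁ = beads-strictlyDecreasing (N + k) pl
      s₂ = beads-strictlyDecreasing N pm

    exchange-contradicts-core : IsCore 0 (c₂ ℤ.+ ℤ.+ k) c₂ (l , m) →
      ∀ x y → Mem x P₂ → ¬ Mem x P₁ → Mem y P₁ → ¬ Mem y P₂ → ⊥
    exchange-contradicts-core (_ , core) x y x∈P₂ x∉P₁ y∈P₁ y∉P₂ =
      x∉P₁ (subst (Mem x) (cong (beads (N + k)) (cong proj₁ ν′≡β)) x∈beads₁′)
      where
      Q₁ = exchanged₁ x y P₁ P₂
      Q₂ = exchanged₂ x y P₁ P₂
      sQ₁ = exchanged₁-strictlyDecreasing x y P₁ P₂ s₁ x∉P₁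
      sQ₂ = exchanged₂-strictlyDecreasing x y P₁ P₂ s₂ y∉P₂
      |Q₁| : length Q₁ ≡ N + k
      |Q₁| = trans (length-exchanged₁ x y P₁ P₂ (AllPairs>⇒Distinct s₁) y∈P₁) (length-beads (N + k) l |l|)
      |Q₂| : length Q₂ ≡ N
      |Q₂| = trans (length-exchanged₂ x y P₁ P₂ (AllPairs>⇒Distinct s₂) x∈P₂) (length-beads N m |m|)
      l′ = partitionWithBeads Q₁
      m′ = partitionWithBeads Q₂
      |l′| : length l′ ≤ N + k
      |l′| = ≤-trans (length-partitionWithBeads Q₁) (≤-reflexive |Q₁|)
      |m′| : length m′ ≤ N
      |m′| = ≤-trans (length-partitionWithBeads Q₂) (≤-reflexive |Q₂|)
      beads₁′ : beads (N + k) l′ ≡ Q₁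
      beads₁′ = subst (λ n → beads n l′ ≡ Q₁) |Q₁| (beads-partitionWithBeads sQ₁)
      beads₂′ : beads N m′ ≡ Q₂
      beads₂′ = subst (λ n → beads n m′ ≡ Q₂) |Q₂| (beads-partitionWithBeads sQ₂)
      x∈beads₁′ : Mem x (beads (N + k) l′)
      x∈beads₁′ = subst (Mem x) (sym beads₁′) (Mem-insert x (remove y P₁))
      ν′≡β : (l′ , m′) ≡ (l , m)
      ν′≡β = core (l′ , m′) (partitionWithBeads-isPartition sQ₁ , partitionWithBeads-isPartition sQ₂)
               (beads-↭⇒content-↭ 0 (c₂ ℤ.+ ℤ.+ k) c₂ (N + k) N l m l′ m′ |l| |m| |l′| |m′| ([c+k]-[n+k]≡c-n c₂ k N)
                 (subst₂ (λ u v → u ++ v ↭ P₁ ++ P₂) (sym beads₁′) (sym beads₂′)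
                   (exchanged-↭ x y P₁ P₂ (AllPairs>⇒Distinct s₁) (AllPairs>⇒Distinct s₂) y∈P₁ x∈P₂)))

    core⇒beads-nested : IsCore 0 (c₂ ℤ.+ ℤ.+ k) c₂ (l , m) → ∀ x → Mem x P₂ → Mem x P₁
    core⇒beads-nested core x x∈P₂ with 0 <? occ x P₁ | Mem-all-or-missing P₂ P₁
    ... | yes x∈P₁ | _                       = x∈P₁
    ... | no x∉P₁  | inj₂ (y , y∈P₁ , y∉P₂) = ⊥-elim (exchange-contradicts-core core x y x∈P₂ x∉P₁ y∈P₁ y∉P₂)
    ... | no x∉P₁  | inj₁ P₁⊆P₂             =
      ⊥-elim (x∉P₁ (subst (0 <_) (sym (⊆-length⇒occ≡ P₁ P₂ (AllPairs>⇒Distinct s₁) P₁⊆P₂ |P₂|≤|P₁| x)) x∈P₂))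
      where
      |P₂|≤|P₁| : length P₂ ≤ length P₁
      |P₂|≤|P₁| rewrite length-beads N m |m| | length-beads (N + k) l |l| = m≤m+n N k

  IsCore0-swap : ∀ d₁ d₂ l m → IsCore 0 d₁ d₂ (l , m) → IsCore 0 d₂ d₁ (m , l)
  IsCore0-swap d₁ d₂ l m ((pl , pm) , core) = (pm , pl) , swapped
    where
    swapped : ∀ ν → IsBipartition ν → content 0 d₂ d₁ ν ↭ content 0 d₂ d₁ (m , l) → ν ≡ (m , l)
    swapped (x , y) (px , py) ν↭ = cong (λ q → proj₂ q , proj₁ q) (core (y , x) (py , px)
      (↭.trans (map⁺ (residue 0) (++-comm (compContents d₁ 1 y) (compContents d₂ 1 x)))
        (↭.trans ν↭ (map⁺ (residue 0) (++-comm (compContents d₂ 1 m) (compContents d₁ 1 l))))))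

  replicate-+ : ∀ {A : Set} p q (z : A) → replicate (p + q) z ≡ replicate p z ++ replicate q z
  replicate-+ zero    q z = refl
  replicate-+ (suc p) q z = cong (z ∷_) (replicate-+ p q z)

  pad-+ : ∀ N a l → length l ≤ N → pad (N + a) l ≡ pad N l ++ replicate a 0
  pad-+ N a l |l|≤N = begin
    l ++ replicate (N + a ∸ length l) 0                    ≡⟨ cong (λ t → l ++ replicate t 0) (+-∸-comm a |l|≤N) ⟩
    l ++ replicate (N ∸ length l + a) 0                    ≡⟨ cong (l ++_) (replicate-+ (N ∸ length l) a 0) ⟩
    l ++ (replicate (N ∸ length l) 0 ++ replicate a 0)     ≡⟨ ++-assoc l _ _ ⟨
    pad N l ++ replicate a 0                               ∎
    where open ≡-Reasoning

  beta-zeros : ∀ a → beta (replicate a 0) ≡ downFrom a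
  beta-zeros zero    = refl
  beta-zeros (suc a) = cong₂ _∷_ (length-replicate a) (beta-zeros a)

  beta-++-zeros : ∀ w a → beta (w ++ replicate a 0) ≡ map (_+ a) (beta w) ++ downFrom a
  beta-++-zeros []      a = beta-zeros a
  beta-++-zeros (x ∷ w) a =
    cong₂ _∷_ (trans (cong (x +_) (trans (length-++ w) (cong (length w +_) (length-replicate a)))) (sym (+-assoc x (length w) a)))
              (beta-++-zeros w a)

  beads-+ : ∀ N a l → length l ≤ N → beads (N + a) l ≡ map (_+ a) (beads N l) ++ downFrom a
  beads-+ N a l |l|≤N = trans (cong beta (pad-+ N a l |l|≤N)) (beta-++-zeros (pad N l) a)

  Mem-downFrom : ∀ {y} a → Mem y (downFrom a) → y < a
  Mem-downFrom {y} (suc a) m with Mem-inv {y} a (downFrom a) m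
  ... | inj₁ refl = ≤-refl
  ... | inj₂ m′   = m≤n⇒m≤1+n (Mem-downFrom a m′)

  Mem-shifted : ∀ a P x → Mem x (map (_+ a) P ++ downFrom a) → a ≤ x → Mem (x ∸ a) P
  Mem-shifted a P x m a≤x
    rewrite count-++ (x ≡ᵇ_) (map (_+ a) P) (downFrom a)
          | ¬Mem⇒occ≡0 x (downFrom a) (λ m′ → <-irrefl refl (<-≤-trans (Mem-downFrom a m′) a≤x))
          | count-map (x ≡ᵇ_) (_+ a) P = subst (0 <_) (trans (+-identityʳ _) (count-cong unshift P)) m
    where
    unshift : ∀ z → (x ≡ᵇ (z + a)) ≡ ((x ∸ a) ≡ᵇ z)
    unshift z = ≡ᵇ-cong-⇔ x (z + a) (x ∸ a) z (λ e → trans (cong (_∸ a) e) (m+n∸n≡m z a))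
                                              (λ e → trans (sym (m∸n+n≡m a≤x)) (cong (_+ a) e))

  -- Residue classes modulo a

  module Modulo (a′ : ℕ) where

    a : ℕ
    a = suc a′

    inClass : ℕ → ℕ → Bool
    inClass ρ x = (x % a) ≡ᵇ (ρ % a)

    inClassBelow : ℕ → ℕ → ℕ → Bool
    inClassBelow t σ x = (x <ᵇ t) ∧ inClass σ x

    classSizeBelow : ℕ → ℕ → ℕ
    classSizeBelow t σ = sumBelow (λ y → 𝟙 (inClass σ y)) t

    %-≡-<⇒+a≤ : ∀ {y u} → y < u → y % a ≡ u % a → y + a ≤ u
    %-≡-<⇒+a≤ {y} {u} y<u e = begin
        y + a                          ≡⟨ cong (_+ a) (m≡m%n+[m/n]*n y a) ⟩
        y % a + (y / a) * a + a        ≡⟨ +-assoc (y % a) _ a ⟩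
        y % a + ((y / a) * a + a)      ≡⟨ cong (y % a +_) (+-comm ((y / a) * a) a) ⟩
        y % a + suc (y / a) * a        ≤⟨ +-mono-≤ (≤-reflexive e) (*-monoˡ-≤ a quotient<) ⟩
        u % a + (u / a) * a            ≡⟨ sym (m≡m%n+[m/n]*n u a) ⟩
        u                              ∎
      where
      open ≤-Reasoning
      quotient< : suc (y / a) ≤ u / a
      quotient< = *-cancelʳ-< a (y / a) (u / a) (+-cancelˡ-< (y % a) _ _
                    (subst (λ z → y % a + (y / a) * a < z + (u / a) * a) (sym e)
                      (subst₂ _<_ (m≡m%n+[m/n]*n y a) (m≡m%n+[m/n]*n u a) y<u)))

    [m∸a]%a≡m%a : ∀ {m} → a ≤ m → (m ∸ a) % a ≡ m % a
    [m∸a]%a≡m%a {m} a≤m = trans (sym ([m+n]%n≡m%n (m ∸ a) a)) (cong (_% a) (m∸n+n≡m a≤m))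

    ≤∸a : ∀ {y u} → y + a ≤ u → y ≤ u ∸ a
    ≤∸a {y} y+a≤u = ≤-trans (≤-reflexive (sym (m+n∸n≡m y a))) (∸-monoˡ-≤ a y+a≤u)

    inClass-self : ∀ y → inClass (y % a) y ≡ true
    inClass-self y = trans (cong ((y % a) ≡ᵇ_) (m%n%n≡m%n y a)) (≡ᵇ-refl (y % a))

    inClass-sound : ∀ σ x → T (inClass σ x) → x % a ≡ σ % a
    inClass-sound σ x = ≡ᵇ⇒≡ _ _

    count-inClassBelow : ∀ t σ X → count (inClassBelow t σ) X ≡ sumBelow (λ y → 𝟙 (inClass σ y) * occ y X) t
    count-inClassBelow t σ []      = sym (trans (sumBelow-cong t (λ y _ → *-zeroʳ (𝟙 (inClass σ y)))) (sumBelow-zero t))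
    count-inClassBelow t σ (x ∷ X) = begin
        𝟙 (inClassBelow t σ x) + count (inClassBelow t σ) X
          ≡⟨ cong₂ _+_ singleton (count-inClassBelow t σ X) ⟩
        sumBelow (λ y → 𝟙 (inClass σ y) * 𝟙 (y ≡ᵇ x)) t + sumBelow (λ y → 𝟙 (inClass σ y) * occ y X) t
          ≡⟨ sym (sumBelow-+ _ _ t) ⟩
        sumBelow (λ y → 𝟙 (inClass σ y) * 𝟙 (y ≡ᵇ x) + 𝟙 (inClass σ y) * occ y X) t
          ≡⟨ sumBelow-cong t (λ y _ → sym (*-distribˡ-+ (𝟙 (inClass σ y)) (𝟙 (y ≡ᵇ x)) (occ y X))) ⟩
        sumBelow (λ y → 𝟙 (inClass σ y) * occ y (x ∷ X)) t ∎
      where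
      open ≡-Reasoning
      swap-point : ∀ y → 𝟙 (inClass σ y) * 𝟙 (y ≡ᵇ x) ≡ 𝟙 (inClass σ x) * 𝟙 (x ≡ᵇ y)
      swap-point y with y ≟ x
      ... | yes refl = refl
      ... | no y≢x rewrite ≢⇒≡ᵇ-false y x y≢x | ≢⇒≡ᵇ-false x y (λ e → y≢x (sym e)) =
        trans (*-zeroʳ (𝟙 (inClass σ y))) (sym (*-zeroʳ (𝟙 (inClass σ x))))
      singleton : 𝟙 (inClassBelow t σ x) ≡ sumBelow (λ y → 𝟙 (inClass σ y) * 𝟙 (y ≡ᵇ x)) t
      singleton = sym (begin
        sumBelow (λ y → 𝟙 (inClass σ y) * 𝟙 (y ≡ᵇ x)) t   ≡⟨ sumBelow-cong t (λ y _ → swap-point y) ⟩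
        sumBelow (λ y → 𝟙 (inClass σ x) * 𝟙 (x ≡ᵇ y)) t   ≡⟨ sumBelow-* (𝟙 (inClass σ x)) _ t ⟩
        𝟙 (inClass σ x) * sumBelow (λ y → 𝟙 (x ≡ᵇ y)) t   ≡⟨ cong (𝟙 (inClass σ x) *_) (sumBelow-indicator x t) ⟩
        𝟙 (inClass σ x) * 𝟙 (x <ᵇ t)                       ≡⟨ *-comm (𝟙 (inClass σ x)) _ ⟩
        𝟙 (x <ᵇ t) * 𝟙 (inClass σ x)                       ≡⟨ sym (𝟙-∧ (x <ᵇ t) (inClass σ x)) ⟩
        𝟙 (inClassBelow t σ x)                              ∎)

    count-inClassBelow≤classSize : ∀ t σ X → Distinct X → count (inClassBelow t σ) X ≤ classSizeBelow t σ
    count-inClassBelow≤classSize t σ X d rewrite count-inClassBelow t σ X =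
      sumBelow-mono t (λ y _ → ≤-trans (*-monoʳ-≤ (𝟙 (inClass σ y)) (d y)) (≤-reflexive (*-identityʳ _)))

    count-inClassBelow≡classSize : ∀ t σ X → Distinct X → (∀ y → y < t → T (inClass σ y) → Mem y X) →
                                   count (inClassBelow t σ) X ≡ classSizeBelow t σ
    count-inClassBelow≡classSize t σ X d full rewrite count-inClassBelow t σ X = sumBelow-cong t present
      where
      present : ∀ y → y < t → 𝟙 (inClass σ y) * occ y X ≡ 𝟙 (inClass σ y)
      present y y<t with inClass σ y in eq
      ... | false = refl
      ... | true  = trans (+-identityʳ (occ y X)) (Distinct⇒occ≡1 {y} {X} d (full y y<t (≡true⇒T eq)))

    count-inClassBelow-suc : ∀ y X → count (inClassBelow (suc y) (y % a)) X ≡ count (inClassBelow y (y % a)) X + occ y X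
    count-inClassBelow-suc y X rewrite count-inClassBelow (suc y) (y % a) X | count-inClassBelow y (y % a) X | inClass-self y =
      cong (sumBelow (λ z → 𝟙 (inClass (y % a) z) * occ z X) y +_) (+-identityʳ (occ y X))

    count-<ᵇ≡sum-classes : ∀ t X → count (_<ᵇ t) X ≡ sumBelow (λ σ → count (inClassBelow t σ) X) a
    count-<ᵇ≡sum-classes t []      = sym (sumBelow-zero a)
    count-<ᵇ≡sum-classes t (x ∷ X) = trans (cong₂ _+_ split-x (count-<ᵇ≡sum-classes t X)) (sym (sumBelow-+ _ _ a))
      where
      open ≡-Reasoning
      one-class : sumBelow (λ σ → 𝟙 (inClass σ x)) a ≡ 1
      one-class = trans (sumBelow-cong a (λ σ σ<a → cong (λ z → 𝟙 ((x % a) ≡ᵇ z)) (m<n⇒m%n≡m σ<a)))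
                        (trans (sumBelow-indicator (x % a) a) (cong 𝟙 (<⇒<ᵇ-true (m%n<n x a))))
      split-x : 𝟙 (x <ᵇ t) ≡ sumBelow (λ σ → 𝟙 (inClassBelow t σ x)) a
      split-x = sym (begin
        sumBelow (λ σ → 𝟙 (inClassBelow t σ x)) a         ≡⟨ sumBelow-cong a (λ σ _ → 𝟙-∧ (x <ᵇ t) (inClass σ x)) ⟩
        sumBelow (λ σ → 𝟙 (x <ᵇ t) * 𝟙 (inClass σ x)) a   ≡⟨ sumBelow-* (𝟙 (x <ᵇ t)) _ a ⟩
        𝟙 (x <ᵇ t) * sumBelow (λ σ → 𝟙 (inClass σ x)) a   ≡⟨ cong (𝟙 (x <ᵇ t) *_) one-class ⟩
        𝟙 (x <ᵇ t) * 1                                     ≡⟨ *-identityʳ _ ⟩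
        𝟙 (x <ᵇ t)                                         ∎)

    -- Bead sets P₁ ⊇ P₂ that interlace on every runner of the a-abacus: each bead of P₁
    -- is at most one step (of length a) above a bead of P₂.
    module Interlaced (P₁ P₂ : List ℕ)
                      (P₂⊆P₁ : ∀ x → Mem x P₂ → Mem x P₁)
                      (P₁-a⊆P₂ : ∀ x → Mem x P₁ → a ≤ x → Mem (x ∸ a) P₂) where

      P₂-closed-below-fuel : ∀ f u → u < f → Mem u P₂ → ∀ y → y ≤ u → y % a ≡ u % a → Mem y P₂
      P₂-closed-below-fuel (suc f) u u<f m y y≤u e with m≤n⇒m<n∨m≡n y≤u
      ... | inj₂ refl = m
      ... | inj₁ y<u  = P₂-closed-below-fuel f (u ∸ a) (≤-trans (∸-monoʳ-< {u} {a} {0} (s≤s z≤n) a≤u) (≤-pred u<f))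
                          (P₁-a⊆P₂ u (P₂⊆P₁ u m) a≤u) y (≤∸a y+a≤u) (trans e (sym ([m∸a]%a≡m%a a≤u)))
        where
        y+a≤u = %-≡-<⇒+a≤ y<u e
        a≤u   = ≤-trans (m≤n+m a y) y+a≤u

      P₂-closed-below : ∀ u → Mem u P₂ → ∀ y → y ≤ u → y % a ≡ u % a → Mem y P₂
      P₂-closed-below u = P₂-closed-below-fuel (suc u) u ≤-refl

      P₁-closed-below : ∀ u → Mem u P₁ → ∀ y → y ≤ u → y % a ≡ u % a → Mem y P₁
      P₁-closed-below u m y y≤u e with m≤n⇒m<n∨m≡n y≤u
      ... | inj₂ refl = m
      ... | inj₁ y<u  = P₂⊆P₁ y (P₂-closed-below (u ∸ a) (P₁-a⊆P₂ u m a≤u) y (≤∸a y+a≤u) (trans e (sym ([m∸a]%a≡m%a a≤u))))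
        where
        y+a≤u = %-≡-<⇒+a≤ y<u e
        a≤u   = ≤-trans (m≤n+m a y) y+a≤u

      Gap : ℕ → ℕ → Set
      Gap σ t = Σ ℕ λ y → y < t × T (inClass σ y) × ¬ Mem y P₂

      class-filled-or-gap : ∀ σ t → (∀ y → y < t → T (inClass σ y) → Mem y P₂) ⊎ Gap σ t
      class-filled-or-gap σ zero = inj₁ (λ y ())
      class-filled-or-gap σ (suc t) with class-filled-or-gap σ t
      ... | inj₂ (y , y<t , c , ∉) = inj₂ (y , m≤n⇒m≤1+n y<t , c , ∉)
      ... | inj₁ filled with inClass σ t in eq | 0 <? occ t P₂
      ... | true | no t∉ = inj₂ (t , ≤-refl , ≡true⇒T eq , t∉)
      ... | false | _ = inj₁ extend
        where
        extend : ∀ y → y < suc t → T (inClass σ y) → Mem y P₂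
        extend y y<1+t c with m≤n⇒m<n∨m≡n (≤-pred y<1+t)
        ... | inj₁ y<t  = filled y y<t c
        ... | inj₂ refl rewrite eq = ⊥-elim c
      ... | true | yes t∈ = inj₁ extend
        where
        extend : ∀ y → y < suc t → T (inClass σ y) → Mem y P₂
        extend y y<1+t c with m≤n⇒m<n∨m≡n (≤-pred y<1+t)
        ... | inj₁ y<t  = filled y y<t c
        ... | inj₂ refl = t∈

      gap-bounds-class : ∀ σ t → Gap σ t → ∀ x → Mem x P₁ ⊎ Mem x P₂ → T (inClass σ x) → x < t
      gap-bounds-class σ t (y , y<t , cy , y∉) x x∈ cx with x <? t
      ... | yes x<t = x<t
      ... | no x≮t  = ⊥-elim (y∉ (below x∈))
        where
        y<x : y < x
        y<x = <-≤-trans y<t (≮⇒≥ x≮t)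
        e : y % a ≡ x % a
        e = trans (inClass-sound σ y cy) (sym (inClass-sound σ x cx))
        below : Mem x P₁ ⊎ Mem x P₂ → Mem y P₂
        below (inj₂ m) = P₂-closed-below x m y (<⇒≤ y<x) e
        below (inj₁ m) = P₂-closed-below (x ∸ a) (P₁-a⊆P₂ x m a≤x) y (≤∸a y+a≤x) (trans e (sym ([m∸a]%a≡m%a a≤x)))
          where
          y+a≤x = %-≡-<⇒+a≤ y<x e
          a≤x   = ≤-trans (m≤n+m a y) y+a≤x

      interlaced-dominates : ∀ Q₁ Q₂ → Distinct P₁ → Distinct P₂ → Distinct Q₁ → Distinct Q₂ →
        (∀ ρ → count (inClass ρ) (Q₁ ++ Q₂) ≡ count (inClass ρ) (P₁ ++ P₂)) →
        ∀ t σ → count (inClassBelow t σ) (Q₁ ++ Q₂) ≤ count (inClassBelow t σ) (P₁ ++ P₂)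
      interlaced-dominates Q₁ Q₂ dP₁ dP₂ dQ₁ dQ₂ same-classes t σ with class-filled-or-gap σ t
      ... | inj₁ filled
        rewrite count-++ (inClassBelow t σ) Q₁ Q₂ | count-++ (inClassBelow t σ) P₁ P₂
              | count-inClassBelow≡classSize t σ P₁ dP₁ (λ y y<t c → P₂⊆P₁ y (filled y y<t c))
              | count-inClassBelow≡classSize t σ P₂ dP₂ filled =
        +-mono-≤ (count-inClassBelow≤classSize t σ Q₁ dQ₁) (count-inClassBelow≤classSize t σ Q₂ dQ₂)
      ... | inj₂ gap = begin
        count (inClassBelow t σ) (Q₁ ++ Q₂)  ≤⟨ count-mono (λ x → proj₂ ∘ Equivalence.to T-∧) (Q₁ ++ Q₂) ⟩
        count (inClass σ) (Q₁ ++ Q₂)         ≡⟨ same-classes σ ⟩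
        count (inClass σ) (P₁ ++ P₂)         ≡⟨ count-cong-Mem (P₁ ++ P₂) all-below ⟨
        count (inClassBelow t σ) (P₁ ++ P₂)  ∎
        where
        open ≤-Reasoning
        all-below : ∀ x → Mem x (P₁ ++ P₂) → inClassBelow t σ x ≡ inClass σ x
        all-below x m with inClass σ x in eq
        ... | false = ∧-zeroʳ (x <ᵇ t)
        ... | true rewrite <⇒<ᵇ-true (gap-bounds-class σ t gap x (Mem-++⁻ {x} P₁ P₂ m) (≡true⇒T eq)) = refl

    dominated⇒occ≡ : ∀ X′ X → length X′ ≡ length X → sum X′ ≡ sum X →
      (∀ ρ → count (inClass ρ) X′ ≡ count (inClass ρ) X) →
      (∀ t σ → count (inClassBelow t σ) X′ ≤ count (inClassBelow t σ) X) →
      ∀ y → occ y X′ ≡ occ y X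
    dominated⇒occ≡ X′ X |X′|≡|X| ΣX′≡ΣX same-classes dominated y =
      +-cancelˡ-≡ (count (inClassBelow y (y % a)) X) _ _ (begin
        count (inClassBelow y (y % a)) X + occ y X′   ≡⟨ cong (_+ occ y X′) (equal-below y (y % a) (m%n<n y a)) ⟨
        count (inClassBelow y (y % a)) X′ + occ y X′  ≡⟨ count-inClassBelow-suc y X′ ⟨
        count (inClassBelow (suc y) (y % a)) X′       ≡⟨ equal-below (suc y) (y % a) (m%n<n y a) ⟩
        count (inClassBelow (suc y) (y % a)) X        ≡⟨ count-inClassBelow-suc y X ⟩
        count (inClassBelow y (y % a)) X + occ y X    ∎)
      where
      open ≡-Reasoning
      bound = suc (maximum (X′ ++ X))
      X′<bound : ∀ x → Mem x X′ → x < bound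
      X′<bound x = <1+maximum-++ˡ X′ X
      X<bound : ∀ x → Mem x X → x < bound
      X<bound x = <1+maximum-++ʳ X′ X
      below-dominated : ∀ t → count (_<ᵇ t) X′ ≤ count (_<ᵇ t) X
      below-dominated t rewrite count-<ᵇ≡sum-classes t X′ | count-<ᵇ≡sum-classes t X = sumBelow-mono a (λ σ _ → dominated t σ)
      S′ = sumBelow (λ t → count (_<ᵇ t) X′) bound
      S  = sumBelow (λ t → count (_<ᵇ t) X) bound
      below-sums : S′ ≡ S
      below-sums = +-cancelʳ-≡ _ _ _ (begin
        S′ + (sum X′ + length X′)  ≡⟨ sumBelow-count-<ᵇ bound X′ X′<bound ⟩
        bound * length X′          ≡⟨ cong (bound *_) |X′|≡|X| ⟩
        bound * length X           ≡⟨ sumBelow-count-<ᵇ bound X X<bound ⟨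
        S + (sum X + length X)     ≡⟨ cong (S +_) (cong₂ _+_ ΣX′≡ΣX |X′|≡|X|) ⟨
        S + (sum X′ + length X′)   ∎)
      above-bound : ∀ t Y → (∀ x → Mem x Y → x < bound) → bound ≤ t → ∀ σ → count (inClassBelow t σ) Y ≡ count (inClass σ) Y
      above-bound t Y Y<bound b≤t σ = count-cong-Mem Y (λ x m → cong (_∧ inClass σ x) (<⇒<ᵇ-true (<-≤-trans (Y<bound x m) b≤t)))
      equal-below : ∀ t σ → σ < a → count (inClassBelow t σ) X′ ≡ count (inClassBelow t σ) X
      equal-below t σ σ<a with t <? bound
      ... | yes t<b = sumBelow-≤-≡⇒≡ a (λ σ _ → dominated t σ)
                        (trans (sym (count-<ᵇ≡sum-classes t X′))
                          (trans (sumBelow-≤-≡⇒≡ bound (λ t _ → below-dominated t) below-sums t t<b) (count-<ᵇ≡sum-classes t X)))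
                        σ σ<a
      ... | no t≮b  = trans (above-bound t X′ X′<bound (≮⇒≥ t≮b) σ)
                        (trans (same-classes σ) (sym (above-bound t X X<bound (≮⇒≥ t≮b) σ)))

    interlaced-unique : ∀ P₁ P₂ Q₁ Q₂ → Distinct P₁ → Distinct P₂ → Distinct Q₁ → Distinct Q₂ →
      (∀ x → Mem x P₂ → Mem x P₁) → (∀ x → Mem x P₁ → a ≤ x → Mem (x ∸ a) P₂) →
      length Q₁ ≡ length P₁ → length Q₂ ≡ length P₂ → sum Q₁ + sum Q₂ ≡ sum P₁ + sum P₂ →
      (∀ ρ → count (inClass ρ) (Q₁ ++ Q₂) ≡ count (inClass ρ) (P₁ ++ P₂)) →
      ∀ y → occ y Q₁ ≡ occ y P₁ × occ y Q₂ ≡ occ y P₂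
    interlaced-unique P₁ P₂ Q₁ Q₂ dP₁ dP₂ dQ₁ dQ₂ P₂⊆P₁ P₁-a⊆P₂ |Q₁| |Q₂| ΣQ same-classes =
      occ-++-split P₁ P₂ Q₁ Q₂ dQ₁ P₂⊆P₁ |Q₁|
        (dominated⇒occ≡ (Q₁ ++ Q₂) (P₁ ++ P₂) lengths sums same-classes
          (Interlaced.interlaced-dominates P₁ P₂ P₂⊆P₁ P₁-a⊆P₂ Q₁ Q₂ dP₁ dP₂ dQ₁ dQ₂ same-classes))
      where
      lengths : length (Q₁ ++ Q₂) ≡ length (P₁ ++ P₂)
      lengths rewrite length-++ Q₁ {Q₂} | length-++ P₁ {P₂} = cong₂ _+_ |Q₁| |Q₂|
      sums : sum (Q₁ ++ Q₂) ≡ sum (P₁ ++ P₂)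
      sums rewrite sum-++ Q₁ Q₂ | sum-++ P₁ P₂ = ΣQ

    +-%-cancelˡ : ∀ m x y → (m + x) % a ≡ (m + y) % a → x % a ≡ y % a
    +-%-cancelˡ m x y e = trans (sym (undo x)) (trans (cong (λ z → (z + m * a′) % a) e) (undo y))
      where
      -- adding m * (a - 1) undoes adding m, modulo a
      undo : ∀ z → ((m + z) % a + m * a′) % a ≡ z % a
      undo z = begin
        ((m + z) % a + m * a′) % a            ≡⟨ %-distribˡ-+ ((m + z) % a) (m * a′) a ⟩
        ((m + z) % a % a + m * a′ % a) % a    ≡⟨ cong (λ u → (u + m * a′ % a) % a) (m%n%n≡m%n (m + z) a) ⟩
        ((m + z) % a + m * a′ % a) % a        ≡⟨ %-distribˡ-+ (m + z) (m * a′) a ⟨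
        (m + z + m * a′) % a                  ≡⟨ cong (_% a) shuffle ⟩
        (z + m * a) % a                       ≡⟨ [m+kn]%n≡m%n z m a ⟩
        z % a                                 ∎
        where
        open ≡-Reasoning
        shuffle : m + z + m * a′ ≡ z + m * a
        shuffle rewrite *-suc m a′ = trans (cong (_+ m * a′) (+-comm m z)) (+-assoc z m (m * a′))

    %-suc-cong : ∀ x y → x % a ≡ y % a → suc x % a ≡ suc y % a
    %-suc-cong x y e = trans (%-distribˡ-+ 1 x a) (trans (cong (λ z → (1 % a + z) % a) e) (sym (%-distribˡ-+ 1 y a)))

    inClass-suc : ∀ ρ v → inClass (suc ρ) (suc v) ≡ inClass ρ v
    inClass-suc ρ v = ≡ᵇ-cong-⇔ _ _ _ _ (+-%-cancelˡ 1 v ρ) (%-suc-cong v ρ)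

    count-inClass-row : ∀ ρ v x → count (inClass ρ) (row v x) + 𝟙 (inClass ρ v) ≡ count (inClass (suc ρ)) (row v x) + 𝟙 (inClass ρ (x + v))
    count-inClass-row ρ v zero    = refl
    count-inClass-row ρ v (suc x) = begin
        𝟙 (inClass ρ (suc v)) + C + 𝟙 (inClass ρ v)       ≡⟨ cong (_+ 𝟙 (inClass ρ v)) (+-comm (𝟙 (inClass ρ (suc v))) C) ⟩
        (C + 𝟙 (inClass ρ (suc v))) + 𝟙 (inClass ρ v)     ≡⟨ cong (_+ 𝟙 (inClass ρ v)) (count-inClass-row ρ (suc v) x) ⟩
        (C′ + 𝟙 (inClass ρ (x + suc v))) + 𝟙 (inClass ρ v) ≡⟨ rotate C′ (𝟙 (inClass ρ (x + suc v))) (𝟙 (inClass ρ v)) ⟩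
        𝟙 (inClass ρ v) + C′ + 𝟙 (inClass ρ (x + suc v))  ≡⟨ cong₂ (λ u w → 𝟙 u + C′ + 𝟙 (inClass ρ w)) (sym (inClass-suc ρ v)) (+-suc x v) ⟩
        𝟙 (inClass (suc ρ) (suc v)) + C′ + 𝟙 (inClass ρ (suc x + v)) ∎
      where
      open ≡-Reasoning
      C  = count (inClass ρ) (row (suc v) x)
      C′ = count (inClass (suc ρ)) (row (suc v) x)
      rotate : ∀ p q s → (p + q) + s ≡ s + p + q
      rotate p q s = trans (+-comm (p + q) s) (sym (+-assoc s p q))

    count-inClass-rows : ∀ ρ w → count (inClass ρ) (rows w) + count (inClass ρ) (downFrom (length w))
                                ≡ count (inClass (suc ρ)) (rows w) + count (inClass ρ) (beta w)
    count-inClass-rows ρ []       = refl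
    count-inClass-rows ρ (x ∷ xs) = begin
        count (inClass ρ) (row L x ++ rows xs) + (𝟙 (inClass ρ L) + V)
          ≡⟨ cong (_+ (𝟙 (inClass ρ L) + V)) (count-++ (inClass ρ) (row L x) (rows xs)) ⟩
        A + B + (𝟙 (inClass ρ L) + V)                       ≡⟨ interchange A B _ V ⟩
        (A + 𝟙 (inClass ρ L)) + (B + V)                      ≡⟨ cong₂ _+_ (count-inClass-row ρ L x) (count-inClass-rows ρ xs) ⟩
        (A′ + 𝟙 (inClass ρ (x + L))) + (B′ + count (inClass ρ) (beta xs))
                                                             ≡⟨ interchange A′ _ B′ _ ⟩
        A′ + B′ + (𝟙 (inClass ρ (x + L)) + count (inClass ρ) (beta xs))
          ≡⟨ cong (_+ (𝟙 (inClass ρ (x + L)) + count (inClass ρ) (beta xs))) (count-++ (inClass (suc ρ)) (row L x) (rows xs)) ⟨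
        count (inClass (suc ρ)) (row L x ++ rows xs) + count (inClass ρ) (beta (x ∷ xs)) ∎
      where
      open ≡-Reasoning
      L  = length xs
      A  = count (inClass ρ) (row L x)
      B  = count (inClass ρ) (rows xs)
      A′ = count (inClass (suc ρ)) (row L x)
      B′ = count (inClass (suc ρ)) (rows xs)
      V  = count (inClass ρ) (downFrom L)

    private
      negative-remainder : ℕ → ℕ
      negative-remainder zero    = 0
      negative-remainder (suc r) = a ∸ suc r

      -[1+n]%ℕa : ∀ n → (-[1+ n ] ℤ.%ℕ a) ≡ negative-remainder (suc n % a)
      -[1+n]%ℕa n with suc n % a
      ... | zero  = refl
      ... | suc r = refl

    [z+a]%ℕa≡z%ℕa : ∀ z → ((z ℤ.+ ℤ.+ a) ℤ.%ℕ a) ≡ (z ℤ.%ℕ a)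
    [z+a]%ℕa≡z%ℕa (ℤ.+ n)    = [m+n]%n≡m%n n a
    [z+a]%ℕa≡z%ℕa -[1+ n ] with suc n ≤? a
    ... | yes 1+n≤a rewrite ℤ.⊖-≥ 1+n≤a | -[1+n]%ℕa n with m≤n⇒m<n∨m≡n 1+n≤a
    ...   | inj₂ refl = trans (cong (_% a) (n∸n≡0 (suc n))) (sym (cong negative-remainder (n%n≡0 (suc n))))
    ...   | inj₁ 1+n<a rewrite m<n⇒m%n≡m 1+n<a = m<n⇒m%n≡m {m = a ∸ suc n} (∸-monoʳ-< {a} {suc n} {0} (s≤s z≤n) 1+n≤a)
    [z+a]%ℕa≡z%ℕa -[1+ n ] | no 1+n≰a =
      trans (cong (ℤ._%ℕ a) shifted)
        (trans (-[1+n]%ℕa (n ∸ a))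
          (trans (cong negative-remainder (trans (cong (_% a) (sym (+-∸-assoc 1 a≤n))) ([m∸a]%a≡m%a (≤-trans a≤n (n≤1+n n)))))
            (sym (-[1+n]%ℕa n))))
      where
      a≤n : a ≤ n
      a≤n = ≤-pred (≰⇒> 1+n≰a)
      shifted : -[1+ n ] ℤ.+ ℤ.+ a ≡ -[1+ (n ∸ a) ]
      shifted = trans (ℤ.⊖-< (≰⇒> 1+n≰a)) (cong ℤ.-_ (cong ℤ.+_ (+-∸-assoc 1 a≤n)))

    [z+ka]%ℕa≡z%ℕa : ∀ z k → ((z ℤ.+ ℤ.+ (k * a)) ℤ.%ℕ a) ≡ (z ℤ.%ℕ a)
    [z+ka]%ℕa≡z%ℕa z zero    = cong (ℤ._%ℕ a) (ℤ.+-identityʳ z)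
    [z+ka]%ℕa≡z%ℕa z (suc k) = trans (cong (ℤ._%ℕ a) regroup) (trans ([z+a]%ℕa≡z%ℕa (z ℤ.+ ℤ.+ (k * a))) ([z+ka]%ℕa≡z%ℕa z k))
      where
      regroup : z ℤ.+ ℤ.+ (a + k * a) ≡ (z ℤ.+ ℤ.+ (k * a)) ℤ.+ ℤ.+ a
      regroup rewrite ℤ.pos-+ a (k * a) = trans (cong (λ u → z ℤ.+ u) (ℤ.+-comm (ℤ.+ a) (ℤ.+ (k * a)))) (sym (ℤ.+-assoc z (ℤ.+ (k * a)) (ℤ.+ a)))

    residue-+a : ∀ z → residue a (z ℤ.+ ℤ.+ a) ≡ residue a z
    residue-+a z = cong ℤ.+_ ([z+a]%ℕa≡z%ℕa z)

    private
      nonnegative-shift : ∀ M → Σ ℕ λ k → Σ ℕ λ m → M ℤ.+ ℤ.+ (k * a) ≡ ℤ.+ m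
      nonnegative-shift (ℤ.+ m)  = 0 , m + 0 , refl
      nonnegative-shift -[1+ n ] = suc n , (suc n * a ∸ suc n) , ℤ.⊖-≥ (m≤m*n (suc n) a)

      shifted-value : ℤ → ℕ
      shifted-value M = proj₁ (proj₂ (nonnegative-shift M))

      [M+x]%ℕa : ∀ M x → ((M ℤ.+ ℤ.+ x) ℤ.%ℕ a) ≡ (shifted-value M + x) % a
      [M+x]%ℕa M x = trans (sym ([z+ka]%ℕa≡z%ℕa (M ℤ.+ ℤ.+ x) k)) (cong (ℤ._%ℕ a) regroup)
        where
        k = proj₁ (nonnegative-shift M)
        regroup : (M ℤ.+ ℤ.+ x) ℤ.+ ℤ.+ (k * a) ≡ ℤ.+ (shifted-value M + x)
        regroup = trans (ℤ.+-assoc M (ℤ.+ x) (ℤ.+ (k * a)))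
                    (trans (cong (λ u → M ℤ.+ u) (ℤ.+-comm (ℤ.+ x) (ℤ.+ (k * a))))
                      (trans (sym (ℤ.+-assoc M (ℤ.+ (k * a)) (ℤ.+ x))) (cong (ℤ._+ ℤ.+ x) (proj₂ (proj₂ (nonnegative-shift M))))))

    residue-offset-≡⇔ : ∀ M x y → residue a (M ℤ.+ ℤ.+ x) ≡ residue a (M ℤ.+ ℤ.+ y) ⇔ x % a ≡ y % a
    residue-offset-≡⇔ M x y = mk⇔
      (λ e → +-%-cancelˡ (shifted-value M) x y (trans (sym ([M+x]%ℕa M x)) (trans (ℤ.+-injective e) ([M+x]%ℕa M y))))
      (λ e → cong ℤ.+_ (trans ([M+x]%ℕa M x) (trans (%-distribˡ-+ (shifted-value M) x a)
               (trans (cong (λ u → (shifted-value M % a + u) % a) e)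
                 (trans (sym (%-distribˡ-+ (shifted-value M) y a)) (sym ([M+x]%ℕa M y)))))))

    residue-offset-≟≡inClass : ∀ M ρ x → ⌊ residue a (M ℤ.+ ℤ.+ x) ℤ.≟ residue a (M ℤ.+ ℤ.+ ρ) ⌋ ≡ inClass ρ x
    residue-offset-≟≡inClass M ρ x with residue a (M ℤ.+ ℤ.+ x) ℤ.≟ residue a (M ℤ.+ ℤ.+ ρ)
    ... | yes e = sym (trans (cong (_≡ᵇ (ρ % a)) (Equivalence.to (residue-offset-≡⇔ M x ρ) e)) (≡ᵇ-refl (ρ % a)))
    ... | no ¬e = sym (≢⇒≡ᵇ-false _ _ (λ e → ¬e (Equivalence.from (residue-offset-≡⇔ M x ρ) e)))

    residues-↭⇒inClass-count : ∀ M C′ C → map (residue a) (map (λ y → M ℤ.+ ℤ.+ y) C′) ↭ map (residue a) (map (λ y → M ℤ.+ ℤ.+ y) C) →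
      ∀ ρ → count (inClass ρ) C′ ≡ count (inClass ρ) C
    residues-↭⇒inClass-count M C′ C C′↭C ρ = trans (sym (via-residues C′)) (trans (count-↭ is-ρ C′↭C) (via-residues C))
      where
      is-ρ = λ z → ⌊ z ℤ.≟ residue a (M ℤ.+ ℤ.+ ρ) ⌋
      via-residues : ∀ X → count is-ρ (map (residue a) (map (λ y → M ℤ.+ ℤ.+ y) X)) ≡ count (inClass ρ) X
      via-residues X = trans (count-map is-ρ (residue a) (map (λ y → M ℤ.+ ℤ.+ y) X))
                         (trans (count-map (λ z → is-ρ (residue a z)) (λ y → M ℤ.+ ℤ.+ y) X) (count-cong (residue-offset-≟≡inClass M ρ) X))

    count-inClass-rows-++ : ∀ ρ W₁ W₂ →
      count (inClass ρ) (rows W₁ ++ rows W₂) + (count (inClass ρ) (downFrom (length W₁)) + count (inClass ρ) (downFrom (length W₂)))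
      ≡ count (inClass (suc ρ)) (rows W₁ ++ rows W₂) + count (inClass ρ) (beta W₁ ++ beta W₂)
    count-inClass-rows-++ ρ W₁ W₂ rewrite count-++ (inClass ρ) (rows W₁) (rows W₂) | count-++ (inClass (suc ρ)) (rows W₁) (rows W₂)
                                        | count-++ (inClass ρ) (beta W₁) (beta W₂) =
      trans (interchange (count (inClass ρ) (rows W₁)) _ _ _)
        (trans (cong₂ _+_ (count-inClass-rows ρ W₁) (count-inClass-rows ρ W₂)) (interchange (count (inClass (suc ρ)) (rows W₁)) _ _ _))

    rows-classes⇒beta-classes : ∀ W₁ W₂ W₁′ W₂′ → length W₁′ ≡ length W₁ → length W₂′ ≡ length W₂ →
      (∀ ρ → count (inClass ρ) (rows W₁′ ++ rows W₂′) ≡ count (inClass ρ) (rows W₁ ++ rows W₂)) →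
      ∀ ρ → count (inClass ρ) (beta W₁′ ++ beta W₂′) ≡ count (inClass ρ) (beta W₁ ++ beta W₂)
    rows-classes⇒beta-classes W₁ W₂ W₁′ W₂′ |W₁′| |W₂′| same ρ = +-cancelˡ-≡ (count (inClass (suc ρ)) C) _ _ (begin
        count (inClass (suc ρ)) C + count (inClass ρ) B′    ≡⟨ cong (_+ count (inClass ρ) B′) (same (suc ρ)) ⟨
        count (inClass (suc ρ)) C′ + count (inClass ρ) B′   ≡⟨ count-inClass-rows-++ ρ W₁′ W₂′ ⟨
        count (inClass ρ) C′ + (V (length W₁′) + V (length W₂′))
                                                            ≡⟨ cong₂ (λ u v → count (inClass ρ) C′ + (V u + V v)) |W₁′| |W₂′| ⟩
        count (inClass ρ) C′ + (V (length W₁) + V (length W₂))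
                                                            ≡⟨ cong (_+ (V (length W₁) + V (length W₂))) (same ρ) ⟩
        count (inClass ρ) C + (V (length W₁) + V (length W₂))
                                                            ≡⟨ count-inClass-rows-++ ρ W₁ W₂ ⟩
        count (inClass (suc ρ)) C + count (inClass ρ) B     ∎)
      where
      open ≡-Reasoning
      C  = rows W₁ ++ rows W₂
      C′ = rows W₁′ ++ rows W₂′
      B  = beta W₁ ++ beta W₂
      B′ = beta W₁′ ++ beta W₂′
      V : ℕ → ℕ
      V n = count (inClass ρ) (downFrom n)

    cores⇒interlaced : ∀ c₂ k d₁ m N {l μ} → IsPartition l → IsPartition μ → length l ≤ N → length μ ≤ N → k + m ≡ a →
      IsCore 0 (c₂ ℤ.+ ℤ.+ k) c₂ (l , μ) → IsCore 0 d₁ (d₁ ℤ.+ ℤ.+ m) (l , μ) →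
      (∀ x → Mem x (beads N μ) → Mem x (beads (N + k) l)) × (∀ x → Mem x (beads (N + k) l) → a ≤ x → Mem (x ∸ a) (beads N μ))
    cores⇒interlaced c₂ k d₁ m N {l} {μ} pl pμ |l| |μ| k+m≡a c-core d-core =
      core⇒beads-nested c₂ k N pl pμ |l|′ |μ| c-core , shifted-nested
      where
      |l|′ = ≤-trans |l| (m≤m+n N k)
      N+k+m≡N+a : N + k + m ≡ N + a
      N+k+m≡N+a = trans (+-assoc N k m) (cong (N +_) k+m≡a)
      shifted-nested : ∀ x → Mem x (beads (N + k) l) → a ≤ x → Mem (x ∸ a) (beads N μ)
      shifted-nested x x∈ a≤x = Mem-shifted a (beads N μ) x
        (subst (Mem x) (trans (cong (λ n → beads n μ) N+k+m≡N+a) (beads-+ N a μ |μ|))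
          (core⇒beads-nested d₁ m (N + k) pμ pl (≤-trans |μ| (≤-trans (m≤m+n N k) (m≤m+n (N + k) m))) |l|′
            (IsCore0-swap d₁ (d₁ ℤ.+ ℤ.+ m) l μ d-core) x x∈))
          a≤x

    module _ (c₂ : ℤ) (k N : ℕ) (l μ l′ μ′ : List ℕ) (|l| : length l ≤ N + k) (|μ| : length μ ≤ N)
             (|l′| : length l′ ≤ N + k) (|μ′| : length μ′ ≤ N) where

      private
        W₁ = pad (N + k) l
        W₂ = pad N μ
        W₁′ = pad (N + k) l′
        W₂′ = pad N μ′
        C  = rows W₁ ++ rows W₂
        C′ = rows W₁′ ++ rows W₂′
        F = λ y → (c₂ ℤ.- ℤ.+ N) ℤ.+ ℤ.+ y
        |W₁′| : length W₁′ ≡ length W₁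
        |W₁′| = trans (length-pad (N + k) l′ |l′|) (sym (length-pad (N + k) l |l|))
        |W₂′| : length W₂′ ≡ length W₂
        |W₂′| = trans (length-pad N μ′ |μ′|) (sym (length-pad N μ |μ|))

      content-↭⇒rows-↭ : content a (c₂ ℤ.+ ℤ.+ k) c₂ (l′ , μ′) ↭ content a (c₂ ℤ.+ ℤ.+ k) c₂ (l , μ) →
        map (residue a) (map F C′) ↭ map (residue a) (map F C)
      content-↭⇒rows-↭ = subst₂ _↭_ (content-rows a _ c₂ (N + k) N l′ μ′ |l′| |μ′| ([c+k]-[n+k]≡c-n c₂ k N))
                                     (content-rows a _ c₂ (N + k) N l μ |l| |μ| ([c+k]-[n+k]≡c-n c₂ k N))

      content-↭⇒sum-beads : content a (c₂ ℤ.+ ℤ.+ k) c₂ (l′ , μ′) ↭ content a (c₂ ℤ.+ ℤ.+ k) c₂ (l , μ) →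
        sum (beads (N + k) l′) + sum (beads N μ′) ≡ sum (beads (N + k) l) + sum (beads N μ)
      content-↭⇒sum-beads ν↭β = begin
        sum (beta W₁′) + sum (beta W₂′)                                           ≡⟨ sum-beta-++ W₁′ W₂′ ⟩
        length C′ + (sum (downFrom (length W₁′)) + sum (downFrom (length W₂′)))   ≡⟨ cong₂ _+_ |C′|≡|C| vacuum ⟩
        length C + (sum (downFrom (length W₁)) + sum (downFrom (length W₂)))      ≡⟨ sum-beta-++ W₁ W₂ ⟨
        sum (beta W₁) + sum (beta W₂)                                             ∎
        where
        open ≡-Reasoning
        rows↭ = content-↭⇒rows-↭ ν↭β
        |C′|≡|C| : length C′ ≡ length C
        |C′|≡|C| = trans (sym (trans (length-map (residue a) (map F C′)) (length-map F C′)))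
                         (trans (↭-length rows↭) (trans (length-map (residue a) (map F C)) (length-map F C)))
        vacuum = cong₂ (λ u v → sum (downFrom u) + sum (downFrom v)) |W₁′| |W₂′|

      content-↭⇒classes-beads : content a (c₂ ℤ.+ ℤ.+ k) c₂ (l′ , μ′) ↭ content a (c₂ ℤ.+ ℤ.+ k) c₂ (l , μ) →
        ∀ ρ → count (inClass ρ) (beads (N + k) l′ ++ beads N μ′) ≡ count (inClass ρ) (beads (N + k) l ++ beads N μ)
      content-↭⇒classes-beads ν↭β =
        rows-classes⇒beta-classes W₁ W₂ W₁′ W₂′ |W₁′| |W₂′| (residues-↭⇒inClass-count (c₂ ℤ.- ℤ.+ N) C′ C (content-↭⇒rows-↭ ν↭β))

    cores⇒core-mod : ∀ c₂ k d₁ m {l μ} → k + m ≡ a → IsCore 0 (c₂ ℤ.+ ℤ.+ k) c₂ (l , μ) → IsCore 0 d₁ (d₁ ℤ.+ ℤ.+ m) (l , μ) →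
      ∀ ν → IsBipartition ν → content a (c₂ ℤ.+ ℤ.+ k) c₂ ν ↭ content a (c₂ ℤ.+ ℤ.+ k) c₂ (l , μ) → ν ≡ (l , μ)
    cores⇒core-mod c₂ k d₁ m {l} {μ} k+m≡a c-core d-core (l′ , μ′) (pl′ , pμ′) ν↭β =
      cong₂ _,_ (beads-injective (N + k) pl′ pl |l′|ₖ |l|ₖ (same-beads (N + k) pl′ pl (proj₁ ∘ same-occ)))
                (beads-injective N pμ′ pμ |μ′| |μ| (same-beads N pμ′ pμ (proj₂ ∘ same-occ)))
      where
      pl = proj₁ (proj₁ c-core)
      pμ = proj₂ (proj₁ c-core)
      N = length l ⊔ length μ ⊔ length l′ ⊔ length μ′
      |l| : length l ≤ N
      |l| = ≤-trans (m≤m⊔n _ _) (≤-trans (m≤m⊔n _ _) (m≤m⊔n _ _))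
      |μ| : length μ ≤ N
      |μ| = ≤-trans (m≤n⊔m (length l) _) (≤-trans (m≤m⊔n _ _) (m≤m⊔n _ _))
      |l′| : length l′ ≤ N
      |l′| = ≤-trans (m≤n⊔m (length l ⊔ length μ) _) (m≤m⊔n _ _)
      |μ′| : length μ′ ≤ N
      |μ′| = m≤n⊔m _ _
      |l|ₖ  = ≤-trans |l| (m≤m+n N k)
      |l′|ₖ = ≤-trans |l′| (m≤m+n N k)
      interlaced = cores⇒interlaced c₂ k d₁ m N pl pμ |l| |μ| k+m≡a c-core d-core
      same-occ : ∀ y → occ y (beads (N + k) l′) ≡ occ y (beads (N + k) l) × occ y (beads N μ′) ≡ occ y (beads N μ)
      same-occ = interlaced-unique (beads (N + k) l) (beads N μ) (beads (N + k) l′) (beads N μ′)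
        (beads-distinct (N + k) pl) (beads-distinct N pμ) (beads-distinct (N + k) pl′) (beads-distinct N pμ′)
        (proj₁ interlaced) (proj₂ interlaced)
        (trans (length-beads (N + k) l′ |l′|ₖ) (sym (length-beads (N + k) l |l|ₖ)))
        (trans (length-beads N μ′ |μ′|) (sym (length-beads N μ |μ|)))
        (content-↭⇒sum-beads c₂ k N l μ l′ μ′ |l|ₖ |μ| |l′|ₖ |μ′| ν↭β)
        (content-↭⇒classes-beads c₂ k N l μ l′ μ′ |l|ₖ |μ| |l′|ₖ |μ′| ν↭β)
      same-beads : ∀ n {x x′} → IsPartition x′ → IsPartition x → (∀ y → occ y (beads n x′) ≡ occ y (beads n x)) → beads n x′ ≡ beads n x
      same-beads n px′ px = AllPairs>-occ-injective (beads-strictlyDecreasing n px′) (beads-strictlyDecreasing n px)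

  -- Cores

  -- Moduli are written suc (suc s′) because IsCore 1 is defined separately.
  coarser-core⇒core-0 : ∀ s′ c₁ c₂ d₁ d₂ (g : ℤ → ℤ) →
    (∀ x y → content (suc (suc s′)) c₁ c₂ (x , y) ≡ map g (compContents d₁ 1 x ++ compContents d₂ 1 y)) →
    ∀ β → IsCore (suc (suc s′)) c₁ c₂ β → IsCore 0 d₁ d₂ β
  coarser-core⇒core-0 s′ c₁ c₂ d₁ d₂ g coarser (l , m) (bip , core) = bip , λ { (x , y) bν ν↭β → core (x , y) bν
    (subst₂ _↭_ (sym (coarser x y)) (sym (coarser l m)) (map⁺ g (subst₂ _↭_ (map-id _) (map-id _) ν↭β))) }

  core-mod⇒core-0 : ∀ s′ c₁ c₂ β → IsCore (suc (suc s′)) c₁ c₂ β → IsCore 0 c₁ c₂ β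
  core-mod⇒core-0 s′ c₁ c₂ = coarser-core⇒core-0 s′ c₁ c₂ c₁ c₂ (residue (suc (suc s′))) (λ x y → refl)

  core-mod⇒translated-core-0 : ∀ s′ d₁ d₂ t β →
    IsCore (suc (suc s′)) (d₁ ℤ.+ (t ℤ.+ ℤ.+ suc (suc s′))) (d₂ ℤ.+ t) β → IsCore 0 d₁ d₂ β
  core-mod⇒translated-core-0 s′ d₁ d₂ t = coarser-core⇒core-0 s′ _ _ d₁ d₂ (λ z → residue A (z ℤ.+ t)) coarser
    where
    A = suc (suc s′)
    coarser : ∀ x y → content A (d₁ ℤ.+ (t ℤ.+ ℤ.+ A)) (d₂ ℤ.+ t) (x , y) ≡ map (λ z → residue A (z ℤ.+ t)) (compContents d₁ 1 x ++ compContents d₂ 1 y)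
    coarser x y = begin
        map (residue A) (compContents (d₁ ℤ.+ (t ℤ.+ ℤ.+ A)) 1 x ++ compContents (d₂ ℤ.+ t) 1 y)
          ≡⟨ cong (map (residue A)) (cong₂ _++_ (compContents-+ d₁ (t ℤ.+ ℤ.+ A) 1 x) (compContents-+ d₂ t 1 y)) ⟩
        map (residue A) (map (ℤ._+ (t ℤ.+ ℤ.+ A)) X ++ map (ℤ._+ t) Y)
          ≡⟨ cong (map (residue A)) (cong (_++ map (ℤ._+ t) Y) (map-cong (λ z → sym (ℤ.+-assoc z t (ℤ.+ A))) X)) ⟩
        map (residue A) (map (λ z → (z ℤ.+ t) ℤ.+ ℤ.+ A) X ++ map (ℤ._+ t) Y)
          ≡⟨ map-++ (residue A) (map (λ z → (z ℤ.+ t) ℤ.+ ℤ.+ A) X) (map (ℤ._+ t) Y) ⟩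
        map (residue A) (map (λ z → (z ℤ.+ t) ℤ.+ ℤ.+ A) X) ++ map (residue A) (map (ℤ._+ t) Y)
          ≡⟨ cong₂ _++_ (trans (sym (map-∘ X)) (map-cong (λ z → Modulo.residue-+a (suc s′) (z ℤ.+ t)) X)) (sym (map-∘ Y)) ⟩
        map (λ z → residue A (z ℤ.+ t)) X ++ map (λ z → residue A (z ℤ.+ t)) Y
          ≡⟨ map-++ (λ z → residue A (z ℤ.+ t)) X Y ⟨
        map (λ z → residue A (z ℤ.+ t)) (X ++ Y) ∎
      where
      open ≡-Reasoning
      X = compContents d₁ 1 x
      Y = compContents d₂ 1 y

  remove-distinct : ∀ y X → Distinct X → Distinct (remove y X)
  remove-distinct y X d r = ≤-trans (≤-trans (m≤m+n _ _) (≤-reflexive (count-remove (r ≡ᵇ_) y X))) (d r)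

  Mem-remove⁺ : ∀ {z} y X → z ≢ y → Mem z X → Mem z (remove y X)
  Mem-remove⁺ {z} y X z≢y z∈X = subst (0 <_) (sym kept) z∈X
    where
    kept : occ z (remove y X) ≡ occ z X
    kept = trans (sym (+-identityʳ _)) (trans (cong (λ b → occ z (remove y X) + 𝟙 b * occ y X) (sym (≢⇒≡ᵇ-false z y z≢y)))
                                            (count-remove (z ≡ᵇ_) y X))

  range⊆⇒≤length : ∀ n X → Distinct X → (∀ y → y < n → Mem y X) → n ≤ length X
  range⊆⇒≤length zero    X d range = z≤n
  range⊆⇒≤length (suc n) X d range = begin
      suc n                       ≤⟨ s≤s (range⊆⇒≤length n (remove n X) (remove-distinct n X d)
                                           (λ y y<n → Mem-remove⁺ n X (<⇒≢ y<n) (range y (m≤n⇒m≤1+n y<n)))) ⟩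
      suc (length (remove n X))   ≡⟨ length-remove n X d (range n ≤-refl) ⟩
      length X                    ∎
    where open ≤-Reasoning

  -- A nonempty partition has its top bead at n - 1 + λ₁ ≥ n, so downward-closed beads would number more than n.
  downClosed-beads⇒empty : ∀ n {l} → IsPartition l → length l ≤ n →
    (∀ u → Mem u (beads n l) → ∀ y → y ≤ u → Mem y (beads n l)) → l ≡ []
  downClosed-beads⇒empty n {[]}         _               _   _      = refl
  downClosed-beads⇒empty n {zero ∷ xs}  (() ∷ _ , _)   _   _
  downClosed-beads⇒empty n {suc x ∷ xs} pl             |l| closed = ⊥-elim (<-irrefl refl (≤-trans (s≤s n≤top) too-many))
    where
    rest = xs ++ replicate (n ∸ length (suc x ∷ xs)) 0
    top = suc x + length rest
    n≤top : n ≤ top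
    n≤top = subst (_≤ top) (length-pad n (suc x ∷ xs) |l|) (s≤s (m≤n+m (length rest) x))
    too-many : suc top ≤ n
    too-many = subst (suc top ≤_) (length-beads n (suc x ∷ xs) |l|)
      (range⊆⇒≤length (suc top) (beads n (suc x ∷ xs)) (beads-distinct n pl)
        (λ y y<1+top → closed top (Mem-head top (beta rest)) y (≤-pred y<1+top)))

  cores-width-one⇒empty : ∀ c₂ d₁ {l μ} → IsCore 0 (c₂ ℤ.+ ℤ.+ 0) c₂ (l , μ) → IsCore 0 d₁ (d₁ ℤ.+ ℤ.+ 1) (l , μ) → (l , μ) ≡ ([] , [])
  cores-width-one⇒empty c₂ d₁ {l} {μ} c-core d-core = cong₂ _,_
      (downClosed-beads⇒empty (N + 0) pl |l|₀ (λ u m y y≤u → P₁-closed-below u m y y≤u (mod-one y u)))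
      (downClosed-beads⇒empty N pμ |μ| (λ u m y y≤u → P₂-closed-below u m y y≤u (mod-one y u)))
    where
    pl = proj₁ (proj₁ c-core)
    pμ = proj₂ (proj₁ c-core)
    N = length l ⊔ length μ
    |l| = m≤m⊔n (length l) (length μ)
    |μ| = m≤n⊔m (length l) (length μ)
    |l|₀ = ≤-trans |l| (m≤m+n N 0)
    mod-one : ∀ y u → y % 1 ≡ u % 1
    mod-one y u = trans (n%1≡0 y) (sym (n%1≡0 u))
    interlaced = Modulo.cores⇒interlaced 0 c₂ 0 d₁ 1 N pl pμ |l| |μ| refl c-core d-core
    open Modulo.Interlaced 0 (beads (N + 0) l) (beads N μ) (proj₁ interlaced) (proj₂ interlaced)

  compContents≡[]⇒[] : ∀ c {x} → All (0 <_) x → compContents c 1 x ≡ [] → x ≡ []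
  compContents≡[]⇒[] c {[]}          _            _  = refl
  compContents≡[]⇒[] c {zero ∷ _}    (() ∷ _)     _
  compContents≡[]⇒[] c {suc _ ∷ _}   _            ()

  empty-isCore0 : ∀ c₁ c₂ → IsCore 0 c₁ c₂ ([] , [])
  empty-isCore0 c₁ c₂ = (([] , []) , ([] , [])) , no-other
    where
    no-other : ∀ ν → IsBipartition ν → content 0 c₁ c₂ ν ↭ content 0 c₁ c₂ ([] , []) → ν ≡ ([] , [])
    no-other (x , y) ((px , _) , (py , _)) ν↭ =
      cong₂ _,_ (compContents≡[]⇒[] c₁ px (++-conicalˡ X Y X++Y≡[])) (compContents≡[]⇒[] c₂ py (++-conicalʳ X Y X++Y≡[]))
      where
      X = compContents c₁ 1 x
      Y = compContents c₂ 1 y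
      X++Y≡[] : X ++ Y ≡ []
      X++Y≡[] = trans (sym (map-id (X ++ Y))) (↭-empty-inv ν↭)

  cores-characterisation : ∀ c₂ d₁ k m′ a β → k + suc m′ ≡ a →
    (IsCore 0 (c₂ ℤ.+ ℤ.+ k) c₂ β × IsCore 0 d₁ (d₁ ℤ.+ ℤ.+ suc m′) β) ⇔ IsCore a (c₂ ℤ.+ ℤ.+ k) c₂ β
  cores-characterisation c₂ d₁ k       m′       zero       β e = ⊥-elim (1+n≢0 (trans (sym (+-suc k m′)) e))
  cores-characterisation c₂ d₁ (suc k) m′       (suc zero) β e = ⊥-elim (1+n≢0 (trans (sym (+-suc k m′)) (suc-injective e)))
  cores-characterisation c₂ d₁ zero    (suc m″) (suc zero) β ()
  cores-characterisation c₂ d₁ zero    zero     (suc zero) β refl = mk⇔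
    (λ (c-core , d-core) → cores-width-one⇒empty c₂ d₁ c-core d-core)
    (λ { refl → empty-isCore0 _ _ , empty-isCore0 _ _ })
  cores-characterisation c₂ d₁ k m′ (suc (suc a″)) β e = mk⇔
    (λ (c-core , d-core) → proj₁ c-core , Modulo.cores⇒core-mod (suc a″) c₂ k d₁ (suc m′) e c-core d-core)
    (λ a-core → core-mod⇒core-0 a″ _ _ β a-core ,
                core-mod⇒translated-core-0 a″ d₁ d₂ t β (subst₂ (λ u v → IsCore (suc (suc a″)) u v β) c₁≡ c₂≡ a-core))
    where
    d₂ = d₁ ℤ.+ ℤ.+ suc m′
    t  = c₂ ℤ.- d₂
    c₂≡ : c₂ ≡ d₂ ℤ.+ t
    c₂≡ = add-difference c₂ d₂
      where
      add-difference : ∀ (c d : ℤ) → c ≡ d ℤ.+ (c ℤ.- d)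
      add-difference = solve-∀
    c₁≡ : c₂ ℤ.+ ℤ.+ k ≡ d₁ ℤ.+ (t ℤ.+ ℤ.+ suc (suc a″))
    c₁≡ rewrite sym e | ℤ.pos-+ k (suc m′) = rearrange c₂ d₁ (ℤ.+ k) (ℤ.+ suc m′)
      where
      rearrange : ∀ (c d K M : ℤ) → c ℤ.+ K ≡ d ℤ.+ ((c ℤ.- (d ℤ.+ M)) ℤ.+ (K ℤ.+ M))
      rearrange = solve-∀

open BipartitionCores using (cores-characterisation)
open import Data.Nat using (ℕ; suc)
import Data.Nat as ℕ
open import Data.Integer using (ℤ; +_; -[1+_]; _-_; _+_; _≤_; _<_; +<+; ∣_∣)
open import Data.Integer.Tactic.RingSolver using (solve-∀)
open import Data.List using (List)
open import Data.Product using (_×_)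
open import Function.Bundles using (_⇔_)
open import Relation.Binary.PropositionalEquality using (_≡_; refl; sym; trans; cong; subst₂)

lemma3p6 : (c₁ c₂ d₁ d₂ : ℤ) → + 0 ≤ c₁ - c₂ → d₁ - d₂ < + 0 →
    (β : List ℕ × List ℕ) →
    (IsCore 0 c₁ c₂ β × IsCore 0 d₁ d₂ β) ⇔ IsCore ∣ (c₁ - c₂) - (d₁ - d₂) ∣ c₁ c₂ β
lemma3p6 c₁ c₂ d₁ d₂ 0≤c₁-c₂ d₁-d₂<0 β with c₁ - c₂ in c₁-c₂≡ | d₁ - d₂ in d₁-d₂≡
... | -[1+ _ ] | _          with () ← 0≤c₁-c₂
... | + k      | + _        with +<+ () ← d₁-d₂<0
... | + k      | -[1+ m′ ] =
  subst₂ (λ u v → (IsCore 0 u c₂ β × IsCore 0 d₁ v β) ⇔ IsCore (k ℕ.+ suc m′) u c₂ β) (sym c₁≡) (sym d₂≡)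
    (cores-characterisation c₂ d₁ k m′ (k ℕ.+ suc m′) β refl)
  where
  c₁≡ : c₁ ≡ c₂ + + k
  c₁≡ = trans (add-difference c₁ c₂) (cong (λ z → c₂ + z) c₁-c₂≡)
    where
    add-difference : ∀ (c d : ℤ) → c ≡ d + (c - d)
    add-difference = solve-∀
  d₂≡ : d₂ ≡ d₁ + + suc m′
  d₂≡ = trans (subtract-difference d₁ d₂) (cong (λ z → d₁ - z) d₁-d₂≡)
    where
    subtract-difference : ∀ (c d : ℤ) → d ≡ c - (c - d)
    subtract-difference = solve-∀
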